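{- Let $n\ge k\ge 3$ be integers. Then \[ \mathrm{ex}(n,K_3,\widehat{P}_k)\le \frac{k-1}{12}\, n^2+\frac{(k-1)^2}{12}\, n, \] and, if moreover $n$ is a multiple of $4\lfloor \frac{k-1}{2}\rfloor$, then \[ \left\lfloor\frac{k-1}{2}\right\rfloor\cdot \frac{n^2}{8}\le \mathrm{ex}(n,K_3,\widehat{P}_k). \]
   Context: For graphs $T$ and $H$ (with no isolated vertices) and a positive integer $n$, the generalized Turán number $\mathrm{ex}(n,T,H)$ is the maximum number of copies of $T$ (subgraphs isomorphic to $T$, not necessarily induced) in an $n$-vertex graph that contains no subgraph isomorphic to $H$. $P_k$ denotes the path with $k$ edges. For a graph $H$, its suspension $\widehat{H}$ is the graph obtained from $H$ by adding one new vertex adjacent to all vertices of $H$. $K_3$ is the triangle. -}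

module Defs where

open import Data.Nat using (ℕ; zero; suc; _+_; _≡ᵇ_; _<ᵇ_)
open import Data.Bool using (Bool; true; false; _∧_; _∨_; if_then_else_)
open import Data.Bool.Properties using (∨-comm)
open import Data.Fin using (Fin; zero; suc; toℕ)
open import Data.Product using (Σ; _×_)
open import Function.Definitions using (Injective)
open import Relation.Binary.PropositionalEquality using (_≡_; refl)
open import Relation.Nullary using (¬_)

record Graph (n : ℕ) : Set where
  field
    adj  : Fin n → Fin n → Bool
    sym  : ∀ i j → adj i j ≡ adj j i
    irr  : ∀ i → adj i i ≡ false
open Graph public

Contains : ∀ {m n} → Graph m → Graph n → Set
Contains {m} {n} H G =
  Σ (Fin m → Fin n) λ f →
    Injective _≡_ _≡_ f × (∀ i j → adj H i j ≡ true → adj G (f i) (f j) ≡ true)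

Free : ∀ {m n} → Graph m → Graph n → Set
Free H G = ¬ Contains H G

private
  n≢suc-n : ∀ n → (n ≡ᵇ suc n) ≡ false
  n≢suc-n zero = refl
  n≢suc-n (suc n) = n≢suc-n n

  path-irr : ∀ n → ((n ≡ᵇ suc n) ∨ (n ≡ᵇ suc n)) ≡ false
  path-irr n with n ≡ᵇ suc n | n≢suc-n n
  ... | .false | refl = refl

-- The path P_k with k edges: vertices 0,…,k, with i ~ j iff |i - j| = 1.
Path : (k : ℕ) → Graph (suc k)
Path k = record
  { adj = λ i j → (toℕ i ≡ᵇ suc (toℕ j)) ∨ (toℕ j ≡ᵇ suc (toℕ i))
  ; sym = λ i j → ∨-comm (toℕ i ≡ᵇ suc (toℕ j)) (toℕ j ≡ᵇ suc (toℕ i))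
  ; irr = λ i → path-irr (toℕ i)
  }

-- The suspension Ĥ: a new vertex (zero) joined to all vertices of H
-- (which become suc i).
suspAdj : ∀ {m} → Graph m → Fin (suc m) → Fin (suc m) → Bool
suspAdj H zero    zero    = false
suspAdj H zero    (suc _) = true
suspAdj H (suc _) zero    = true
suspAdj H (suc i) (suc j) = adj H i j

suspSym : ∀ {m} (H : Graph m) i j → suspAdj H i j ≡ suspAdj H j i
suspSym H zero    zero    = refl
suspSym H zero    (suc _) = refl
suspSym H (suc _) zero    = refl
suspSym H (suc i) (suc j) = sym H i j

suspIrr : ∀ {m} (H : Graph m) i → suspAdj H i i ≡ false
suspIrr H zero    = refl
suspIrr H (suc i) = irr H i

Susp : ∀ {m} → Graph m → Graph (suc m)
Susp H = record { adj = suspAdj H ; sym = suspSym H ; irr = suspIrr H }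

sumFin : ∀ n → (Fin n → ℕ) → ℕ
sumFin zero    f = 0
sumFin (suc n) f = f zero + sumFin n (λ i → f (suc i))

triangles : ∀ {n} → Graph n → ℕ
triangles {n} G =
  sumFin n λ a → sumFin n λ b → sumFin n λ c →
    if (toℕ a <ᵇ toℕ b) ∧ (toℕ b <ᵇ toℕ c)
       ∧ adj G a b ∧ adj G b c ∧ adj G a c
    then 1 else 0

module Submission where

-- Proposition 1.3.  Write K = k - 1.  Upper bound: in a graph G with no
-- suspension of P_(K+1), no neighbourhood N(v) contains a path on K + 2
-- vertices, so by Erdős–Gallai 2e(G[N(v)]) ≤ K·d(v).  Summing over v, the
-- number T = 6t(G) of ordered triangles satisfies T ≤ K·D with D = Σ d = 2e;
-- counting common neighbours along edges gives 2Σd² ≤ T + nD, and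
-- Cauchy–Schwarz gives D² ≤ nΣd²; together 2T ≤ Kn² + K²n.  Erdős–Gallai is
-- proved by cutting off "pieces" of the vertex set (a vertex of degree ≤ K/2,
-- or a closed part of maximum degree ≤ K) found by growing a path and closing
-- it with Pósa's crossing chords.  Lower bound: for m = ⌊K/2⌋ and n = 4qm, q
-- disjoint copies of K_{m,m} joined completely to an independent set of n/2
-- vertices contain no suspended P_(K+1) (a neighbourhood path would have to
-- fit inside one block) and contain q·m²·(n/2) triangles.

open import Defs hiding (sym)
open import Data.Nat
  using (ℕ; zero; suc; _+_; _*_; _∸_; _/_; _%_; _≤_; _<_; z≤n; s≤s; s≤s⁻¹; _≤?_; _<?_; _≟_; _≡ᵇ_; _<ᵇ_; ⌊_/2⌋)
open import Data.Nat.Properties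
open import Data.Nat.DivMod using (m≡m%n+[m/n]*n; m%n<n; [m+kn]%n≡m%n; m<n⇒m%n≡m; m/n*n≤m; m≥n⇒m/n>0)
open import Data.Nat.Divisibility using (_∣_; divides)
open import Data.Nat.Tactic.RingSolver using (solve-∀)
open import Data.Bool using (Bool; true; false; not; _∧_; _∨_; _xor_; if_then_else_; T)
open import Data.Bool.Properties
  using (¬-not; not-injective; ∧-assoc; ∧-comm; ∧-identityʳ; ∧-zeroʳ; ∨-zeroʳ; xor-comm; xor-same)
  renaming (_≟_ to _≟ᵇ_)
open import Data.Fin using (Fin; zero; suc; toℕ; fromℕ<)
open import Data.Fin.Properties
  using (any?; pigeonhole; toℕ<n; toℕ-injective; toℕ-fromℕ<)
  renaming (_≟_ to _≟ᶠ_; suc-injective to Fin-suc-injective)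
open import Data.Product using (Σ; _×_; _,_; proj₁; proj₂)
open import Data.Sum using (_⊎_; inj₁; inj₂)
open import Data.Unit using (tt)
open import Data.Empty using (⊥; ⊥-elim)
open import Function.Base using (_∘_)
open import Relation.Nullary using (does; yes; no)
open import Relation.Nullary.Decidable using (dec-true)
open import Relation.Binary.Definitions using (tri<; tri≈; tri>)
open import Relation.Binary.PropositionalEquality
open import Algebra.Properties.Semiring.Sum +-*-semiring
  using (sum; sum-cong-≗; ∑-distrib-+; ∑-comm; *-distribˡ-sum)
open import Algebra.Properties.CommutativeSemigroup *-commutativeSemigroup using (x∙yz≈y∙xz)
open import Algebra.Properties.CommutativeSemigroup +-commutativeSemigroup
  using () renaming (xy∙z≈xz∙y to +-right-comm)

open Graph using () renaming (sym to adj-sym)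

⟦_⟧ : Bool → ℕ
⟦ b ⟧ = if b then 1 else 0

⟦⟧≤1 : ∀ b → ⟦ b ⟧ ≤ 1
⟦⟧≤1 true  = s≤s z≤n
⟦⟧≤1 false = z≤n

⟦∧⟧ : ∀ a b → ⟦ a ∧ b ⟧ ≡ ⟦ a ⟧ * ⟦ b ⟧
⟦∧⟧ true  b = sym (+-identityʳ ⟦ b ⟧)
⟦∧⟧ false b = refl

⟦∧⟧≤ʳ : ∀ a b → ⟦ a ∧ b ⟧ ≤ ⟦ b ⟧
⟦∧⟧≤ʳ true  b = ≤-refl
⟦∧⟧≤ʳ false b = z≤n

⟦⟧+⟦⟧≤⟦∧⟧+1 : ∀ p q → ⟦ p ⟧ + ⟦ q ⟧ ≤ ⟦ p ∧ q ⟧ + 1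
⟦⟧+⟦⟧≤⟦∧⟧+1 true  true  = ≤-refl
⟦⟧+⟦⟧≤⟦∧⟧+1 true  false = ≤-refl
⟦⟧+⟦⟧≤⟦∧⟧+1 false q     = ⟦⟧≤1 q

<ᵇ-true : ∀ {x y} → x < y → (x <ᵇ y) ≡ true
<ᵇ-true {x} {y} x<y with x <ᵇ y in e
... | true  = refl
... | false = ⊥-elim (subst T e (<⇒<ᵇ x<y))

<ᵇ-false : ∀ {x y} → y ≤ x → (x <ᵇ y) ≡ false
<ᵇ-false {x} {y} y≤x with x <ᵇ y in e
... | false = refl
... | true  = ⊥-elim (<⇒≱ (<ᵇ⇒< x y (subst T (sym e) tt)) y≤x)

<ᵇ-sound : ∀ {x y} → (x <ᵇ y) ≡ true → x < y
<ᵇ-sound {x} {y} e = <ᵇ⇒< x y (subst T (sym e) tt)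

<ᵇ-sound-false : ∀ {x y} → (x <ᵇ y) ≡ false → y ≤ x
<ᵇ-sound-false {x} {y} e = ≮⇒≥ (λ x<y → subst T e (<⇒<ᵇ x<y))

≡ᵇ-sound : ∀ {m n} → (m ≡ᵇ n) ≡ true → m ≡ n
≡ᵇ-sound {m} {n} e = ≡ᵇ⇒≡ m n (subst T (sym e) tt)

≡ᵇ-refl : ∀ a → (a ≡ᵇ a) ≡ true
≡ᵇ-refl zero    = refl
≡ᵇ-refl (suc a) = ≡ᵇ-refl a

≡ᵇ-sym : ∀ a b → (a ≡ᵇ b) ≡ (b ≡ᵇ a)
≡ᵇ-sym zero    zero    = refl
≡ᵇ-sym zero    (suc b) = refl
≡ᵇ-sym (suc a) zero    = refl
≡ᵇ-sym (suc a) (suc b) = ≡ᵇ-sym a b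

sumFin≡sum : ∀ n (f : Fin n → ℕ) → sumFin n f ≡ sum f
sumFin≡sum zero    f = refl
sumFin≡sum (suc n) f = cong (f zero +_) (sumFin≡sum n (f ∘ suc))

sumFin-cong : ∀ n {f g : Fin n → ℕ} → (∀ i → f i ≡ g i) → sumFin n f ≡ sumFin n g
sumFin-cong zero    e = refl
sumFin-cong (suc n) e = cong₂ _+_ (e zero) (sumFin-cong n (e ∘ suc))

sumFin-mono : ∀ n {f g : Fin n → ℕ} → (∀ i → f i ≤ g i) → sumFin n f ≤ sumFin n g
sumFin-mono zero    e = z≤n
sumFin-mono (suc n) e = +-mono-≤ (e zero) (sumFin-mono n (e ∘ suc))

sumFin-+ : ∀ n (f g : Fin n → ℕ) →
  sumFin n (λ i → f i + g i) ≡ sumFin n f + sumFin n g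
sumFin-+ n f g = begin
  sumFin n (λ i → f i + g i) ≡⟨ sumFin≡sum n _ ⟩
  sum (λ i → f i + g i)      ≡⟨ ∑-distrib-+ f g ⟩
  sum f + sum g              ≡⟨ sym (cong₂ _+_ (sumFin≡sum n f) (sumFin≡sum n g)) ⟩
  sumFin n f + sumFin n g    ∎
  where open ≡-Reasoning

sumFin-*ˡ : ∀ n c (f : Fin n → ℕ) → sumFin n (λ i → c * f i) ≡ c * sumFin n f
sumFin-*ˡ n c f = begin
  sumFin n (λ i → c * f i) ≡⟨ sumFin≡sum n _ ⟩
  sum (λ i → c * f i)      ≡⟨ sym (*-distribˡ-sum c f) ⟩
  c * sum f                ≡⟨ cong (c *_) (sym (sumFin≡sum n f)) ⟩
  c * sumFin n f           ∎
  where open ≡-Reasoning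

sumFin-*ʳ : ∀ n c (f : Fin n → ℕ) → sumFin n (λ i → f i * c) ≡ sumFin n f * c
sumFin-*ʳ n c f = trans (sumFin-cong n (λ i → *-comm (f i) c))
                        (trans (sumFin-*ˡ n c f) (*-comm c _))

sumFin-const : ∀ n c → sumFin n (λ _ → c) ≡ n * c
sumFin-const zero    c = refl
sumFin-const (suc n) c = cong (c +_) (sumFin-const n c)

sumFin-zero : ∀ n → sumFin n (λ _ → 0) ≡ 0
sumFin-zero n = trans (sumFin-const n 0) (*-zeroʳ n)

sumFin-swap : ∀ n m (f : Fin n → Fin m → ℕ) →
  sumFin n (λ i → sumFin m (f i)) ≡ sumFin m (λ j → sumFin n (λ i → f i j))
sumFin-swap n m f = begin
  sumFin n (λ i → sumFin m (f i))         ≡⟨ trans (sumFin≡sum n _) (sum-cong-≗ (λ i → sumFin≡sum m (f i))) ⟩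
  sum (λ i → sum (f i))                   ≡⟨ ∑-comm f ⟩
  sum (λ j → sum (λ i → f i j))           ≡⟨ sym (trans (sumFin≡sum m _) (sum-cong-≗ (λ j → sumFin≡sum n (λ i → f i j)))) ⟩
  sumFin m (λ j → sumFin n (λ i → f i j)) ∎
  where open ≡-Reasoning

sumFin-term : ∀ n (f : Fin n → ℕ) i → f i ≤ sumFin n f
sumFin-term (suc n) f zero    = m≤m+n (f zero) _
sumFin-term (suc n) f (suc i) = ≤-trans (sumFin-term n (f ∘ suc) i) (m≤n+m _ (f zero))

_==_ : ∀ {n} → Fin n → Fin n → Bool
a == b = does (a ≟ᶠ b)

==-refl : ∀ {n} (a : Fin n) → (a == a) ≡ true
==-refl a = dec-true (a ≟ᶠ a) refl

==-sound : ∀ {n} {a b : Fin n} → (a == b) ≡ true → a ≡ b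
==-sound {a = a} {b} e with a ≟ᶠ b
... | yes a≡b = a≡b

sumFin-point : ∀ n (a : Fin n) (g : Fin n → ℕ) → sumFin n (λ w → ⟦ a == w ⟧ * g w) ≡ g a
sumFin-point (suc n) zero g =
  trans (cong₂ _+_ (*-identityˡ (g zero)) (sumFin-zero n)) (+-identityʳ (g zero))
sumFin-point (suc n) (suc a) g = sumFin-point n a (g ∘ suc)

-- Sums over a range of naturals: sumTo L g = g 0 + ⋯ + g (L ∸ 1).  Paths are
-- indexed by naturals, so counting along a path uses these sums.
sumTo : ℕ → (ℕ → ℕ) → ℕ
sumTo zero    g = 0
sumTo (suc L) g = g 0 + sumTo L (g ∘ suc)

sumTo-cong : ∀ L {f g : ℕ → ℕ} → (∀ i → i < L → f i ≡ g i) → sumTo L f ≡ sumTo L g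
sumTo-cong zero    e = refl
sumTo-cong (suc L) e = cong₂ _+_ (e 0 (s≤s z≤n)) (sumTo-cong L (λ i i<L → e (suc i) (s≤s i<L)))

sumTo-mono : ∀ L {f g : ℕ → ℕ} → (∀ i → i < L → f i ≤ g i) → sumTo L f ≤ sumTo L g
sumTo-mono zero    e = z≤n
sumTo-mono (suc L) e = +-mono-≤ (e 0 (s≤s z≤n)) (sumTo-mono L (λ i i<L → e (suc i) (s≤s i<L)))

sumTo-const : ∀ L c → sumTo L (λ _ → c) ≡ L * c
sumTo-const zero    c = refl
sumTo-const (suc L) c = cong (c +_) (sumTo-const L c)

sumTo-*ˡ : ∀ L c g → sumTo L (λ i → c * g i) ≡ c * sumTo L g
sumTo-*ˡ zero    c g = sym (*-zeroʳ c)
sumTo-*ˡ (suc L) c g = trans (cong (c * g 0 +_) (sumTo-*ˡ L c (g ∘ suc))) (sym (*-distribˡ-+ c (g 0) _))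

sumTo-snoc : ∀ L (g : ℕ → ℕ) → sumTo (suc L) g ≡ sumTo L g + g L
sumTo-snoc zero    g = +-comm (g 0) 0
sumTo-snoc (suc L) g = trans (cong (g 0 +_) (sumTo-snoc L (g ∘ suc))) (sym (+-assoc (g 0) _ _))

sumTo-term : ∀ L (g : ℕ → ℕ) j → j < L → g j ≤ sumTo L g
sumTo-term (suc L) g zero    _         = m≤m+n (g 0) _
sumTo-term (suc L) g (suc j) (s≤s j<L) = ≤-trans (sumTo-term L (g ∘ suc) j j<L) (m≤n+m _ (g 0))

sumTo-≤-length : ∀ L (g : ℕ → ℕ) → (∀ i → i < L → g i ≤ 1) → sumTo L g ≤ L
sumTo-≤-length zero    g b = z≤n
sumTo-≤-length (suc L) g b =
  +-mono-≤ (b 0 (s≤s z≤n)) (sumTo-≤-length L (g ∘ suc) (λ i i<L → b (suc i) (s≤s i<L)))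

sumTo-hole : ∀ L (g : ℕ → ℕ) j → j < suc L → g j ≡ 0 →
             (∀ i → i < suc L → g i ≤ 1) → sumTo (suc L) g ≤ L
sumTo-hole L g zero _ g0≡0 b rewrite g0≡0 =
  sumTo-≤-length L (g ∘ suc) (λ i i<L → b (suc i) (s≤s i<L))
sumTo-hole (suc L) g (suc j) (s≤s j<) gj≡0 b =
  +-mono-≤ (b 0 (s≤s z≤n)) (sumTo-hole L (g ∘ suc) j j< gj≡0 (λ i i<L → b (suc i) (s≤s i<L)))

sumTo-split : ∀ a b h → sumTo (a + b) h ≡ sumTo a h + sumTo b (λ i → h (a + i))
sumTo-split zero    b h = refl
sumTo-split (suc a) b h =
  trans (cong (h 0 +_) (sumTo-split a b (h ∘ suc))) (sym (+-assoc (h 0) _ _))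

sumTo-prefix : ∀ a b h → sumTo a h ≤ sumTo (a + b) h
sumTo-prefix a b h = ≤-trans (m≤m+n _ _) (≤-reflexive (sym (sumTo-split a b h)))

sumTo-suffix : ∀ a b h → sumTo b (λ i → h (a + i)) ≤ sumTo (a + b) h
sumTo-suffix a b h = ≤-trans (m≤n+m _ _) (≤-reflexive (sym (sumTo-split a b h)))

sumTo-blocks : ∀ q M h → sumTo (q * M) h ≡ sumTo q (λ c → sumTo M (λ r → h (c * M + r)))
sumTo-blocks zero    M h = refl
sumTo-blocks (suc q) M h =
  trans (sumTo-split M (q * M) h)
        (cong (sumTo M h +_)
          (trans (sumTo-blocks q M (λ i → h (M + i)))
                 (sumTo-cong q (λ c _ → sumTo-cong M (λ r _ → cong h (sym (+-assoc M (c * M) r)))))))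

sumFin-toℕ : ∀ N (h : ℕ → ℕ) → sumFin N (λ i → h (toℕ i)) ≡ sumTo N h
sumFin-toℕ zero    h = refl
sumFin-toℕ (suc N) h = cong (h 0 +_) (sumFin-toℕ N (h ∘ suc))

sumTo-sumFin-swap : ∀ L n (f : ℕ → Fin n → ℕ) →
  sumTo L (λ j → sumFin n (f j)) ≡ sumFin n (λ w → sumTo L (λ j → f j w))
sumTo-sumFin-swap zero    n f = sym (sumFin-zero n)
sumTo-sumFin-swap (suc L) n f =
  trans (cong (sumFin n (f 0) +_) (sumTo-sumFin-swap L n (f ∘ suc))) (sym (sumFin-+ n (f 0) _))

cover : ∀ n L (g : ℕ → Fin n) (Q : Fin n → Bool) →
  (∀ w → Q w ≡ true → Σ ℕ λ j → j < L × g j ≡ w) →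
  sumFin n (λ w → ⟦ Q w ⟧) ≤ sumTo L (λ j → ⟦ Q (g j) ⟧)
cover n L g Q covered = begin
  sumFin n (λ w → ⟦ Q w ⟧)                              ≤⟨ sumFin-mono n hit ⟩
  sumFin n (λ w → sumTo L (λ j → ⟦ g j == w ⟧ * ⟦ Q w ⟧)) ≡⟨ sumTo-sumFin-swap L n _ ⟨
  sumTo L (λ j → sumFin n (λ w → ⟦ g j == w ⟧ * ⟦ Q w ⟧)) ≡⟨ sumTo-cong L (λ j _ → sumFin-point n (g j) (λ w → ⟦ Q w ⟧)) ⟩
  sumTo L (λ j → ⟦ Q (g j) ⟧)                           ∎
  where
  open ≤-Reasoning
  hit : ∀ w → ⟦ Q w ⟧ ≤ sumTo L (λ j → ⟦ g j == w ⟧ * ⟦ Q w ⟧)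
  hit w with Q w in Qw
  ... | false = z≤n
  ... | true with covered w Qw
  ... | j , j<L , refl = ≤-trans (≤-reflexive (cong (λ b → ⟦ b ⟧ * 1) (sym (==-refl (g j)))))
                                 (sumTo-term L _ j j<L)

search : ∀ {n} (q : Fin n → Bool) → (Σ (Fin n) λ y → q y ≡ true) ⊎ (∀ y → q y ≡ false)
search q with any? (λ y → q y ≟ᵇ true)
... | yes found = inj₁ found
... | no  none  = inj₂ (λ y → ¬-not (λ qy → none (y , qy)))

anyBelow : ℕ → (ℕ → Bool) → Bool
anyBelow zero    h = false
anyBelow (suc L) h = h 0 ∨ anyBelow L (h ∘ suc)

anyBelow-witness : ∀ L h → anyBelow L h ≡ true → Σ ℕ λ j → j < L × h j ≡ true
anyBelow-witness (suc L) h e with h 0 in h0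
... | true  = 0 , s≤s z≤n , h0
... | false with anyBelow-witness L (h ∘ suc) e
... | j , j<L , hj = suc j , s≤s j<L , hj

anyBelow-intro : ∀ L h j → j < L → h j ≡ true → anyBelow L h ≡ true
anyBelow-intro (suc L) h zero    _       hj rewrite hj = refl
anyBelow-intro (suc L) h (suc j) (s≤s q) hj with h 0
... | true  = refl
... | false = anyBelow-intro L (h ∘ suc) j q hj

CommonIndex : ℕ → (ℕ → Bool) → (ℕ → Bool) → Set
CommonIndex l f g = Σ ℕ λ i → i < l × f i ≡ true × g i ≡ true

common-index-suc : ∀ {l f g} → CommonIndex l (f ∘ suc) (g ∘ suc) → CommonIndex (suc l) f g
common-index-suc (i , i<l , fi , gi) = suc i , s≤s i<l , fi , gi

common-index : ∀ l (f g : ℕ → Bool) →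
  l < sumTo l (λ i → ⟦ f i ⟧) + sumTo l (λ i → ⟦ g i ⟧) → CommonIndex l f g
common-index (suc l) f g big with f 0 in f0 | g 0 in g0
... | true  | true  = 0 , s≤s z≤n , f0 , g0
... | true  | false = common-index-suc (common-index l (f ∘ suc) (g ∘ suc) (s≤s⁻¹ big))
... | false | true  = common-index-suc (common-index l (f ∘ suc) (g ∘ suc) (s≤s⁻¹ (subst (suc l <_) (+-suc _ _) big)))
... | false | false = common-index-suc (common-index l (f ∘ suc) (g ∘ suc) (≤-trans (n≤1+n _) big))

∧-true : ∀ {a b} → a ∧ b ≡ true → a ≡ true × b ≡ true
∧-true {true} {true} _ = refl , refl

∨-true : ∀ {a b} → a ∨ b ≡ true → a ≡ true ⊎ b ≡ true
∨-true {true}  _ = inj₁ refl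
∨-true {false} e = inj₂ e

ordered : ℕ → ℕ → ℕ → ℕ
ordered x y z = ⟦ (x <ᵇ y) ∧ (y <ᵇ z) ⟧

arrangements : ℕ → ℕ → ℕ → ℕ
arrangements x y z =
  ordered x y z + ordered x z y + ordered y x z + ordered y z x + ordered z x y + ordered z y x

arrangements-swap₁₂ : ∀ x y z → arrangements x y z ≡ arrangements y x z
arrangements-swap₁₂ x y z = shuffle (ordered x y z) (ordered x z y) (ordered y x z)
                                     (ordered y z x) (ordered z x y) (ordered z y x)
  where
  shuffle : ∀ a b c d e f → a + b + c + d + e + f ≡ c + d + a + b + f + e
  shuffle = solve-∀

arrangements-swap₂₃ : ∀ x y z → arrangements x y z ≡ arrangements x z y
arrangements-swap₂₃ x y z = shuffle (ordered x y z) (ordered x z y) (ordered y x z)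
                                     (ordered y z x) (ordered z x y) (ordered z y x)
  where
  shuffle : ∀ a b c d e f → a + b + c + d + e + f ≡ b + a + e + f + c + d
  shuffle = solve-∀

-- For sorted x ≤ y ≤ z only the arrangement x, y, z can be increasing.
arrangements-sorted : ∀ {x y z} → x ≤ y → y ≤ z → arrangements x y z ≤ 1
arrangements-sorted {x} {y} {z} x≤y y≤z
  rewrite <ᵇ-false x≤y | <ᵇ-false y≤z | <ᵇ-false (≤-trans x≤y y≤z)
        | ∧-zeroʳ (x <ᵇ z) | ∧-zeroʳ (y <ᵇ z) =
  ≤-trans (≤-reflexive (drop-zeros (ordered x y z))) (⟦⟧≤1 _)
  where
  drop-zeros : ∀ a → a + 0 + 0 + 0 + 0 + 0 ≡ a
  drop-zeros = solve-∀

arrangements≤1 : ∀ x y z → arrangements x y z ≤ 1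
arrangements≤1 x y z with ≤-total x y | ≤-total y z | ≤-total x z
... | inj₁ x≤y | inj₁ y≤z | _        = arrangements-sorted x≤y y≤z
... | inj₁ x≤y | inj₂ z≤y | inj₁ x≤z =
  subst (_≤ 1) (sym (arrangements-swap₂₃ x y z)) (arrangements-sorted x≤z z≤y)
... | inj₁ x≤y | inj₂ z≤y | inj₂ z≤x =
  subst (_≤ 1) (sym (trans (arrangements-swap₂₃ x y z) (arrangements-swap₁₂ x z y)))
        (arrangements-sorted z≤x x≤y)
... | inj₂ y≤x | inj₁ y≤z | inj₁ x≤z =
  subst (_≤ 1) (sym (arrangements-swap₁₂ x y z)) (arrangements-sorted y≤x x≤z)
... | inj₂ y≤x | inj₁ y≤z | inj₂ z≤x =
  subst (_≤ 1) (sym (trans (arrangements-swap₁₂ x y z) (arrangements-swap₂₃ y x z)))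
        (arrangements-sorted y≤z z≤x)
... | inj₂ y≤x | inj₂ z≤y | _        =
  subst (_≤ 1) (sym (trans (arrangements-swap₁₂ x y z)
                     (trans (arrangements-swap₂₃ y x z) (arrangements-swap₁₂ y z x))))
        (arrangements-sorted z≤y y≤x)

∸-suc : ∀ m n → n < m → m ∸ n ≡ suc (m ∸ suc n)
∸-suc (suc m) zero    _       = refl
∸-suc (suc m) (suc n) (s≤s p) = ∸-suc m n p

module Paths {n : ℕ} (G : Graph n) (S : Fin n → Bool) where

  record IsPath (L : ℕ) (p : ℕ → Fin n) : Set where
    constructor mkPath
    field
      inS  : ∀ i → i < L → S (p i) ≡ true
      step : ∀ i → suc i < L → adj G (p i) (p (suc i)) ≡ true
      inj  : ∀ i j → i < L → j < L → p i ≡ p j → i ≡ j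
  open IsPath public

  Avoids : ℕ → (ℕ → Fin n) → Fin n → Set
  Avoids L p y = ∀ j → j < L → p j ≡ y → ⊥

  _◁_ : Fin n → (ℕ → Fin n) → ℕ → Fin n
  (y ◁ p) zero    = y
  (y ◁ p) (suc i) = p i

  prepend : ∀ {L p y} → IsPath L p → S y ≡ true → adj G y (p 0) ≡ true → Avoids L p y →
            IsPath (suc L) (y ◁ p)
  prepend {L} {p} {y} P Sy y~p0 avoids = mkPath inS′ step′ inj′
    where
    inS′ : ∀ i → i < suc L → S ((y ◁ p) i) ≡ true
    inS′ zero    _       = Sy
    inS′ (suc i) (s≤s q) = inS P i q
    step′ : ∀ i → suc i < suc L → adj G ((y ◁ p) i) ((y ◁ p) (suc i)) ≡ true
    step′ zero    _       = y~p0
    step′ (suc i) (s≤s q) = step P i q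
    inj′ : ∀ i j → i < suc L → j < suc L → (y ◁ p) i ≡ (y ◁ p) j → i ≡ j
    inj′ zero    zero    _       _       _ = refl
    inj′ zero    (suc j) _       (s≤s q) e = ⊥-elim (avoids j q (sym e))
    inj′ (suc i) zero    (s≤s q) _       e = ⊥-elim (avoids i q e)
    inj′ (suc i) (suc j) (s≤s q) (s≤s r) e = cong suc (inj P i j q r e)

  reverse : ℕ → (ℕ → Fin n) → ℕ → Fin n
  reverse l p i = p (l ∸ i)

  reverse-path : ∀ {l p} → IsPath (suc l) p → IsPath (suc l) (reverse l p)
  reverse-path {l} {p} P = mkPath inS′ step′ inj′
    where
    inS′ : ∀ i → i < suc l → S (p (l ∸ i)) ≡ true
    inS′ i _ = inS P (l ∸ i) (s≤s (m∸n≤m l i))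
    step′ : ∀ i → suc i < suc l → adj G (p (l ∸ i)) (p (l ∸ suc i)) ≡ true
    step′ i (s≤s q) rewrite ∸-suc l i q =
      trans (adj-sym G _ _) (step P (l ∸ suc i) (s≤s (subst (_≤ l) (∸-suc l i q) (m∸n≤m l i))))
    inj′ : ∀ i j → i < suc l → j < suc l → p (l ∸ i) ≡ p (l ∸ j) → i ≡ j
    inj′ i j (s≤s q) (s≤s r) e =
      ∸-cancelˡ-≡ q r (inj P _ _ (s≤s (m∸n≤m l i)) (s≤s (m∸n≤m l j)) e)

  reverse-avoids : ∀ {l p y} → Avoids (suc l) p y → Avoids (suc l) (reverse l p) y
  reverse-avoids {l} avoids j _ e = avoids (l ∸ j) (s≤s (m∸n≤m l j)) e

  IsCycle : ℕ → (ℕ → Fin n) → Set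
  IsCycle l c = IsPath (suc l) c × adj G (c l) (c 0) ≡ true

  next : ℕ → ℕ → ℕ
  next l t with t ≟ l
  ... | yes _ = 0
  ... | no  _ = suc t

  next-cases : ∀ l t → t ≤ l → (t ≡ l × next l t ≡ 0) ⊎ (t < l × next l t ≡ suc t)
  next-cases l t t≤l with t ≟ l
  ... | yes t≡l = inj₁ (t≡l , refl)
  ... | no  t≢l = inj₂ (≤∧≢⇒< t≤l t≢l , refl)

  next-last : ∀ l → next l l ≡ 0
  next-last l with l ≟ l
  ... | yes _   = refl
  ... | no  l≢l = ⊥-elim (l≢l refl)

  next-< : ∀ l t → t < l → next l t ≡ suc t
  next-< l t t<l with t ≟ l
  ... | yes t≡l = ⊥-elim (<-irrefl t≡l t<l)
  ... | no  _   = refl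

  next-≤ : ∀ l t → t ≤ l → next l t ≤ l
  next-≤ l t t≤l with t ≟ l
  ... | yes _   = z≤n
  ... | no  t≢l = ≤∧≢⇒< t≤l t≢l

  next-inj : ∀ l t u → next l t ≡ next l u → t ≡ u
  next-inj l t u e with t ≟ l | u ≟ l
  ... | yes t≡l | yes u≡l = trans t≡l (sym u≡l)
  ... | no  _   | no  _   = suc-injective e
  ... | yes _   | no  _   with () ← e
  ... | no  _   | yes _   with () ← e

  rotate-cycle : ∀ {l c} → IsCycle l c → IsCycle l (c ∘ next l)
  rotate-cycle {l} {c} (P , closing) = mkPath inS′ step′ inj′ , closing′
    where
    c-step-next : ∀ t → t ≤ l → adj G (c t) (c (next l t)) ≡ true
    c-step-next t t≤l with next-cases l t t≤l
    ... | inj₁ (refl , e) rewrite e = closing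
    ... | inj₂ (t<l  , e) rewrite e = step P t (s≤s t<l)
    inS′ : ∀ i → i < suc l → S (c (next l i)) ≡ true
    inS′ i (s≤s q) = inS P _ (s≤s (next-≤ l i q))
    step′ : ∀ i → suc i < suc l → adj G (c (next l i)) (c (next l (suc i))) ≡ true
    step′ i (s≤s q) rewrite next-< l i q = c-step-next (suc i) q
    inj′ : ∀ i j → i < suc l → j < suc l → c (next l i) ≡ c (next l j) → i ≡ j
    inj′ i j (s≤s q) (s≤s r) e =
      next-inj l i j (inj P _ _ (s≤s (next-≤ l i q)) (s≤s (next-≤ l j r)) e)
    closing′ : adj G (c (next l l)) (c (next l 0)) ≡ true
    closing′ rewrite next-last l = c-step-next 0 z≤n

  rotate : ℕ → ℕ → (ℕ → Fin n) → ℕ → Fin n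
  rotate l zero    c = c
  rotate l (suc s) c = rotate l s (c ∘ next l)

  rotate-isCycle : ∀ l s {c} → IsCycle l c → IsCycle l (rotate l s c)
  rotate-isCycle l zero    C = C
  rotate-isCycle l (suc s) C = rotate-isCycle l s (rotate-cycle C)

  rotate-head : ∀ l s c → s ≤ l → rotate l s c 0 ≡ c s
  rotate-head l zero    c _   = refl
  rotate-head l (suc s) c s≤l =
    trans (rotate-head l s (c ∘ next l) (≤-trans (n≤1+n s) s≤l)) (cong c (next-< l s s≤l))

  rotate-avoids : ∀ l s {c y} → Avoids (suc l) c y → Avoids (suc l) (rotate l s c) y
  rotate-avoids l zero    avoids = avoids
  rotate-avoids l (suc s) avoids =
    rotate-avoids l s (λ j q e → avoids (next l j) (s≤s (next-≤ l j (s≤s⁻¹ q))) e)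

  -- Crossing chords p 0 ~ p (i + 1) and p l ~ p i close a path on l + 1 vertices
  -- into the cycle p 0, …, p i, p l, p (l ∸ 1), …, p (i + 1), whose index
  -- sequence is `crossing l i`.
  crossing : ℕ → ℕ → ℕ → ℕ
  crossing l i t with t ≤? i
  ... | yes _ = t
  ... | no  _ = (l + suc i) ∸ t

  crossing-low : ∀ l i t → t ≤ i → crossing l i t ≡ t
  crossing-low l i t t≤i with t ≤? i
  ... | yes _   = refl
  ... | no  t≰i = ⊥-elim (t≰i t≤i)

  crossing-high : ∀ l i t → i < t → crossing l i t ≡ (l + suc i) ∸ t
  crossing-high l i t i<t with t ≤? i
  ... | yes t≤i = ⊥-elim (<⇒≱ i<t t≤i)
  ... | no  _   = refl

  reflect-≤ : ∀ l i t → i < t → (l + suc i) ∸ t ≤ l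
  reflect-≤ l i t i<t = subst ((l + suc i) ∸ t ≤_) (m+n∸n≡m l (suc i)) (∸-monoʳ-≤ (l + suc i) i<t)

  crossing-≤ : ∀ l i t → t ≤ l → crossing l i t ≤ l
  crossing-≤ l i t t≤l with t ≤? i
  ... | yes _   = t≤l
  ... | no  t≰i = reflect-≤ l i t (≰⇒> t≰i)

  crossing-involutive : ∀ l i t → t ≤ l → crossing l i (crossing l i t) ≡ t
  crossing-involutive l i t t≤l with t ≤? i
  ... | yes t≤i = crossing-low l i t t≤i
  ... | no  _   = trans (crossing-high l i _ i<reflected) (m∸[m∸n]≡n (≤-trans t≤l (m≤m+n l (suc i))))
    where
    i<reflected : i < (l + suc i) ∸ t
    i<reflected = subst (_≤ (l + suc i) ∸ t) (m+n∸m≡n l (suc i)) (∸-monoʳ-≤ (l + suc i) t≤l)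

  crossing-cycle : ∀ {l i p} → i < l → IsPath (suc l) p →
                   adj G (p 0) (p (suc i)) ≡ true → adj G (p l) (p i) ≡ true →
                   IsCycle l (p ∘ crossing l i)
  crossing-cycle {l} {i} {p} i<l P p0~pi+1 pl~pi = mkPath inS′ step′ inj′ , closing
    where
    inS′ : ∀ t → t < suc l → S (p (crossing l i t)) ≡ true
    inS′ t (s≤s q) = inS P _ (s≤s (crossing-≤ l i t q))
    inj′ : ∀ t u → t < suc l → u < suc l → p (crossing l i t) ≡ p (crossing l i u) → t ≡ u
    inj′ t u (s≤s q) (s≤s r) e = begin
      t                                 ≡⟨ crossing-involutive l i t q ⟨
      crossing l i (crossing l i t)     ≡⟨ cong (crossing l i) (inj P _ _ (s≤s (crossing-≤ l i t q)) (s≤s (crossing-≤ l i u r)) e) ⟩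
      crossing l i (crossing l i u)     ≡⟨ crossing-involutive l i u r ⟩
      u                                 ∎
      where open ≡-Reasoning
    closing : adj G (p (crossing l i l)) (p (crossing l i 0)) ≡ true
    closing rewrite crossing-high l i l i<l | crossing-low l i 0 z≤n | m+n∸m≡n l (suc i) =
      trans (adj-sym G _ _) p0~pi+1
    -- On the reflected part consecutive cycle vertices are path neighbours in reverse.
    reflected-step : ∀ t → i < t → suc t ≤ l →
                     adj G (p ((l + suc i) ∸ t)) (p ((l + suc i) ∸ suc t)) ≡ true
    reflected-step t i<t t<l rewrite ∸-suc (l + suc i) t (≤-trans t<l (m≤m+n l (suc i))) =
      trans (adj-sym G _ _)
            (step P _ (s≤s (subst (_≤ l) (∸-suc (l + suc i) t (≤-trans t<l (m≤m+n l (suc i))))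
                                   (reflect-≤ l i t i<t))))
    step′ : ∀ t → suc t < suc l → adj G (p (crossing l i t)) (p (crossing l i (suc t))) ≡ true
    step′ t (s≤s q) with <-cmp t i
    ... | tri< t<i _ _ rewrite crossing-low l i t (<⇒≤ t<i) | crossing-low l i (suc t) t<i =
      step P t (s≤s q)
    ... | tri≈ _ refl _ rewrite crossing-low l i i ≤-refl | crossing-high l i (suc i) ≤-refl
                              | m+n∸n≡m l (suc i) = trans (adj-sym G _ _) pl~pi
    ... | tri> _ _ i<t rewrite crossing-high l i t i<t | crossing-high l i (suc t) (≤-trans i<t (n≤1+n t)) =
      reflected-step t i<t q

  -- A vertex y of S outside a path that closes by crossing chords, but adjacent
  -- to one of its vertices, yields a path on l + 2 vertices: open the cycle
  -- next to that vertex and prepend y.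
  extend-through-cycle : ∀ {l i p y j} → i < l → IsPath (suc l) p →
    adj G (p 0) (p (suc i)) ≡ true → adj G (p l) (p i) ≡ true →
    S y ≡ true → Avoids (suc l) p y → j ≤ l → adj G (p j) y ≡ true →
    Σ (ℕ → Fin n) (IsPath (suc (suc l)))
  extend-through-cycle {l} {i} {p} {y} {j} i<l P chord₀ chordₗ Sy avoids j≤l pj~y =
    y ◁ c′ , prepend (proj₁ (rotate-isCycle l s C)) Sy y~head
                     (rotate-avoids l s (λ t q → avoids _ (s≤s (crossing-≤ l i t (s≤s⁻¹ q)))))
    where
    C : IsCycle l (p ∘ crossing l i)
    C = crossing-cycle i<l P chord₀ chordₗ
    s : ℕ
    s = crossing l i j
    c′ : ℕ → Fin n
    c′ = rotate l s (p ∘ crossing l i)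
    y~head : adj G y (c′ 0) ≡ true
    y~head rewrite rotate-head l s (p ∘ crossing l i) (crossing-≤ l i j j≤l)
                 | crossing-involutive l i j j≤l = trans (adj-sym G _ _) pj~y

  singleton : ∀ {x} → S x ≡ true → IsPath 1 (λ _ → x)
  singleton {x} Sx = mkPath (λ _ _ → Sx) (λ { _ (s≤s ()) }) only-index
    where
    only-index : ∀ i j → i < 1 → j < 1 → x ≡ x → i ≡ j
    only-index zero    zero    _       _       _ = refl
    only-index zero    (suc _) _       (s≤s ()) _
    only-index (suc _) _       (s≤s ()) _       _

IsPath-mono : ∀ {n} {G : Graph n} {C S : Fin n → Bool} → (∀ w → C w ≡ true → S w ≡ true) →
              ∀ {L p} → Paths.IsPath G C L p → Paths.IsPath G S L p
IsPath-mono C⊆S P = Paths.mkPath (λ i i<L → C⊆S _ (Paths.inS P i i<L)) (Paths.step P) (Paths.inj P)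

module Degrees {n : ℕ} (G : Graph n) where

  VSet : Set
  VSet = Fin n → Bool

  _⊆_ : VSet → VSet → Set
  C ⊆ S = ∀ w → C w ≡ true → S w ≡ true

  _∖_ : VSet → VSet → VSet
  (S ∖ C) w = S w ∧ not (C w)

  size : VSet → ℕ
  size S = sumFin n (λ a → ⟦ S a ⟧)

  deg : VSet → Fin n → ℕ
  deg S a = sumFin n (λ b → ⟦ S b ∧ adj G a b ⟧)

  -- Sum of the degrees in G[S], i.e. twice its number of edges.
  degSum : VSet → ℕ
  degSum S = sumFin n (λ a → ⟦ S a ⟧ * deg S a)

  cross : VSet → VSet → ℕ
  cross C D = sumFin n (λ a → ⟦ C a ⟧ * deg D a)

  Splits : VSet → VSet → VSet → Set
  Splits S C D = ∀ w → ⟦ S w ⟧ ≡ ⟦ C w ⟧ + ⟦ D w ⟧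

  splits-∖ : ∀ {S C} → C ⊆ S → Splits S C (S ∖ C)
  splits-∖ {S} {C} C⊆S w with C w in Cw
  ... | true  rewrite C⊆S w Cw = refl
  ... | false rewrite ∧-identityʳ (S w) = refl

  size-split : ∀ {S C D} → Splits S C D → size S ≡ size C + size D
  size-split {S} {C} {D} split = trans (sumFin-cong n split) (sumFin-+ n _ _)

  deg-split : ∀ {S C D} → Splits S C D → ∀ a → deg S a ≡ deg C a + deg D a
  deg-split {S} {C} {D} split a = trans (sumFin-cong n term) (sumFin-+ n _ _)
    where
    term : ∀ b → ⟦ S b ∧ adj G a b ⟧ ≡ ⟦ C b ∧ adj G a b ⟧ + ⟦ D b ∧ adj G a b ⟧
    term b rewrite ⟦∧⟧ (S b) (adj G a b) | ⟦∧⟧ (C b) (adj G a b) | ⟦∧⟧ (D b) (adj G a b) | split b =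
      *-distribʳ-+ _ ⟦ C b ⟧ ⟦ D b ⟧

  cross-sym : ∀ C D → cross D C ≡ cross C D
  cross-sym C D = begin
    sumFin n (λ a → ⟦ D a ⟧ * deg C a)                               ≡⟨ sumFin-cong n (λ a → sumFin-*ˡ n ⟦ D a ⟧ _) ⟨
    sumFin n (λ a → sumFin n (λ b → ⟦ D a ⟧ * ⟦ C b ∧ adj G a b ⟧)) ≡⟨ sumFin-swap n n _ ⟩
    sumFin n (λ b → sumFin n (λ a → ⟦ D a ⟧ * ⟦ C b ∧ adj G a b ⟧)) ≡⟨ sumFin-cong n (λ b → sumFin-cong n (λ a → term a b)) ⟩
    sumFin n (λ b → sumFin n (λ a → ⟦ C b ⟧ * ⟦ D a ∧ adj G b a ⟧)) ≡⟨ sumFin-cong n (λ b → sumFin-*ˡ n ⟦ C b ⟧ _) ⟩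
    sumFin n (λ b → ⟦ C b ⟧ * deg D b)                               ∎
    where
    open ≡-Reasoning
    term : ∀ a b → ⟦ D a ⟧ * ⟦ C b ∧ adj G a b ⟧ ≡ ⟦ C b ⟧ * ⟦ D a ∧ adj G b a ⟧
    term a b rewrite ⟦∧⟧ (C b) (adj G a b) | ⟦∧⟧ (D a) (adj G b a) | adj-sym G a b =
      x∙yz≈y∙xz ⟦ D a ⟧ ⟦ C b ⟧ _

  degSum-split : ∀ {S C D} → Splits S C D → degSum S ≡ degSum C + degSum D + 2 * cross C D
  degSum-split {S} {C} {D} split = begin
    degSum S                                                  ≡⟨ sumFin-cong n term ⟩
    sumFin n (λ a → (⟦ C a ⟧ * deg C a + ⟦ D a ⟧ * deg D a)
                  + (⟦ C a ⟧ * deg D a + ⟦ D a ⟧ * deg C a)) ≡⟨ sumFin-+ n _ _ ⟩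
    sumFin n (λ a → ⟦ C a ⟧ * deg C a + ⟦ D a ⟧ * deg D a)
      + sumFin n (λ a → ⟦ C a ⟧ * deg D a + ⟦ D a ⟧ * deg C a) ≡⟨ cong₂ _+_ (sumFin-+ n _ _) (sumFin-+ n _ _) ⟩
    degSum C + degSum D + (cross C D + cross D C)            ≡⟨ cong (λ z → degSum C + degSum D + (cross C D + z)) (cross-sym C D) ⟩
    degSum C + degSum D + (cross C D + cross C D)            ≡⟨ cong (degSum C + degSum D +_) (cong (cross C D +_) (+-identityʳ _)) ⟨
    degSum C + degSum D + 2 * cross C D                      ∎
    where
    open ≡-Reasoning
    term : ∀ a → ⟦ S a ⟧ * deg S a ≡ (⟦ C a ⟧ * deg C a + ⟦ D a ⟧ * deg D a)
                                     + (⟦ C a ⟧ * deg D a + ⟦ D a ⟧ * deg C a)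
    term a rewrite split a | deg-split split a = expand ⟦ C a ⟧ ⟦ D a ⟧ (deg C a) (deg D a)
      where
      expand : ∀ c d x y → (c + d) * (x + y) ≡ (c * x + d * y) + (c * y + d * x)
      expand = solve-∀

  -- Cutting
  -- off pieces repeatedly is how the Erdős–Gallai bound is proved.
  record Piece (K : ℕ) (S : VSet) : Set where
    field
      part     : VSet
      part⊆S   : part ⊆ S
      nonempty : 1 ≤ size part
      bound    : degSum part + 2 * cross part (S ∖ part) ≤ K * size part

  piece-bound : ∀ {K S C D} → Splits S C D →
    degSum C + 2 * cross C D ≤ K * size C → degSum D ≤ K * size D → degSum S ≤ K * size S
  piece-bound {K} {S} {C} {D} split boundC boundD = begin
    degSum S                               ≡⟨ degSum-split {S} {C} {D} split ⟩
    degSum C + degSum D + 2 * cross C D    ≡⟨ +-right-comm (degSum C) _ _ ⟩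
    (degSum C + 2 * cross C D) + degSum D  ≤⟨ +-mono-≤ boundC boundD ⟩
    K * size C + K * size D                ≡⟨ *-distribˡ-+ K (size C) (size D) ⟨
    K * (size C + size D)                  ≡⟨ cong (K *_) (size-split split) ⟨
    K * size S                             ∎
    where open ≤-Reasoning

  low-piece : ∀ {K S} x → S x ≡ true → 2 * deg S x ≤ K → Piece K S
  low-piece {K} {S} x Sx 2deg≤K = record
    { part = x ==_ ; part⊆S = part⊆S ; nonempty = ≤-reflexive (sym size≡1) ; bound = bound }
    where
    part⊆S : (x ==_) ⊆ S
    part⊆S w e = subst (λ v → S v ≡ true) (==-sound e) Sx
    size≡1 : size (x ==_) ≡ 1
    size≡1 = trans (sumFin-cong n (λ w → sym (*-identityʳ _))) (sumFin-point n x (λ _ → 1))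
    no-loop : degSum (x ==_) ≡ 0
    no-loop = begin
      degSum (x ==_)                                ≡⟨ sumFin-point n x _ ⟩
      sumFin n (λ b → ⟦ (x == b) ∧ adj G x b ⟧)     ≡⟨ sumFin-cong n (λ b → ⟦∧⟧ (x == b) _) ⟩
      sumFin n (λ b → ⟦ x == b ⟧ * ⟦ adj G x b ⟧)   ≡⟨ sumFin-point n x _ ⟩
      ⟦ adj G x x ⟧                                 ≡⟨ cong ⟦_⟧ (irr G x) ⟩
      0                                             ∎
      where open ≡-Reasoning
    edges-out : cross (x ==_) (S ∖ (x ==_)) ≤ deg S x
    edges-out = ≤-trans (≤-reflexive (sumFin-point n x _))
                        (sumFin-mono n (λ b → ∧-≤ (S b) _ _))
      where
      ∧-≤ : ∀ a b c → ⟦ (a ∧ b) ∧ c ⟧ ≤ ⟦ a ∧ c ⟧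
      ∧-≤ true  b c = ⟦∧⟧≤ʳ b c
      ∧-≤ false b c = z≤n
    bound : degSum (x ==_) + 2 * cross (x ==_) (S ∖ (x ==_)) ≤ K * size (x ==_)
    bound rewrite no-loop | size≡1 | *-identityʳ K = ≤-trans (*-monoʳ-≤ 2 edges-out) 2deg≤K

  -- A nonempty part of S closed under S-adjacency in which every degree is at
  -- most K is a piece (it has no edges to the rest of S).
  closed-piece : ∀ {K S} C x → C ⊆ S →
    (∀ a b → C a ≡ true → S b ≡ true → adj G a b ≡ true → C b ≡ true) →
    (∀ a → C a ≡ true → deg C a ≤ K) → C x ≡ true → Piece K S
  closed-piece {K} {S} C x C⊆S closed deg≤K Cx = record
    { part = C ; part⊆S = C⊆S ; nonempty = nonempty ; bound = bound }
    where
    nonempty : 1 ≤ size C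
    nonempty = subst (λ b → ⟦ b ⟧ ≤ size C) Cx (sumFin-term n (λ a → ⟦ C a ⟧) x)
    no-edges-out : cross C (S ∖ C) ≡ 0
    no-edges-out = trans (sumFin-cong n term) (sumFin-zero n)
      where
      edge : ∀ a → C a ≡ true → ∀ b → ⟦ (S ∖ C) b ∧ adj G a b ⟧ ≡ 0
      edge a Ca b with S b in Sb | adj G a b in a~b
      ... | false | _     = refl
      ... | true  | false = cong ⟦_⟧ (∧-zeroʳ _)
      ... | true  | true  rewrite closed a b Ca Sb a~b = refl
      term : ∀ a → ⟦ C a ⟧ * deg (S ∖ C) a ≡ 0
      term a with C a in Ca
      ... | false = refl
      ... | true  = cong (1 *_) (trans (sumFin-cong n (edge a Ca)) (sumFin-zero n))
    degSum≤ : degSum C ≤ K * size C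
    degSum≤ = ≤-trans (sumFin-mono n term) (≤-reflexive (trans (sumFin-*ʳ n K _) (*-comm (size C) K)))
      where
      term : ∀ a → ⟦ C a ⟧ * deg C a ≤ ⟦ C a ⟧ * K
      term a with C a in Ca
      ... | false = z≤n
      ... | true  = *-monoʳ-≤ 1 (deg≤K a Ca)
    bound : degSum C + 2 * cross C (S ∖ C) ≤ K * size C
    bound rewrite no-edges-out | +-identityʳ (degSum C) = degSum≤

module ErdosGallai {n : ℕ} (G : Graph n) where
  open Degrees G

  -- G[S] contains no path on K + 2 vertices, i.e. no path with K + 1 edges.
  NoLongPath : ℕ → VSet → Set
  NoLongPath K S = ∀ p → Paths.IsPath G S (suc (suc K)) p → ⊥

  -- Growing a path greedily inside S, rotating it à la Pósa when it gets
  -- stuck, either produces a forbidden long path or exhibits a piece.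
  module FindPiece (K : ℕ) (S : VSet) (noLongPath : NoLongPath K S) where
    open Paths G S

    onPath : (ℕ → Fin n) → ℕ → VSet
    onPath p l y = anyBelow (suc l) (λ j → p j == y)

    onPath-intro : ∀ {p l j} → j < suc l → onPath p l (p j) ≡ true
    onPath-intro {p} {l} {j} j≤l = anyBelow-intro (suc l) (λ i → p i == p j) j j≤l (==-refl (p j))

    onPath-witness : ∀ {p l y} → onPath p l y ≡ true → Σ ℕ λ j → j < suc l × p j ≡ y
    onPath-witness {p} {l} {y} on with anyBelow-witness (suc l) (λ j → p j == y) on
    ... | j , j≤l , pj==y = j , j≤l , ==-sound pj==y

    offPath-avoids : ∀ {p l y} → onPath p l y ≡ false → Avoids (suc l) p y
    offPath-avoids {p} {l} off j j≤l refl with trans (sym (onPath-intro {p} {l} j≤l)) off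
    ... | ()

    freshNbr : (ℕ → Fin n) → ℕ → Fin n → VSet
    freshNbr p l v y = S y ∧ (adj G v y ∧ not (onPath p l y))

    Saturated : (ℕ → Fin n) → ℕ → Fin n → Set
    Saturated p l v = ∀ y → S y ≡ true → adj G v y ≡ true → onPath p l y ≡ true

    saturated : ∀ p l {v} → (∀ y → freshNbr p l v y ≡ false) → Saturated p l v
    saturated p l {v} none y Sy v~y with onPath p l y in on
    ... | true  = refl
    ... | false with none y
    ... | stale rewrite Sy | v~y | on with () ← stale

    deg-on-path : ∀ p l {a} → Saturated p l a → deg S a ≤ sumTo (suc l) (λ j → ⟦ adj G a (p j) ⟧)
    deg-on-path p l {a} sat =
      ≤-trans (cover n (suc l) p (λ w → S w ∧ adj G a w) covered)
              (sumTo-mono (suc l) (λ j _ → ⟦∧⟧≤ʳ (S (p j)) (adj G a (p j))))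
      where
      covered : ∀ w → (S w ∧ adj G a w) ≡ true → Σ ℕ λ j → j < suc l × p j ≡ w
      covered w h with ∧-true h
      ... | Sw , a~w = onPath-witness (sat w Sw a~w)

    -- For the two ends of the path, the vertex itself does not count.
    head-degree : ∀ p l → Saturated p l (p 0) →
                  deg S (p 0) ≤ sumTo l (λ i → ⟦ adj G (p 0) (p (suc i)) ⟧)
    head-degree p l sat =
      subst (λ b → deg S (p 0) ≤ ⟦ b ⟧ + sumTo l (λ i → ⟦ adj G (p 0) (p (suc i)) ⟧))
            (irr G (p 0)) (deg-on-path p l sat)

    last-degree : ∀ p l → Saturated p l (p l) →
                  deg S (p l) ≤ sumTo l (λ i → ⟦ adj G (p l) (p i) ⟧)
    last-degree p l sat = begin
      deg S (p l)                                          ≤⟨ deg-on-path p l sat ⟩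
      sumTo (suc l) (λ j → ⟦ adj G (p l) (p j) ⟧)          ≡⟨ sumTo-snoc l _ ⟩
      sumTo l (λ j → ⟦ adj G (p l) (p j) ⟧) + ⟦ adj G (p l) (p l) ⟧ ≡⟨ cong (λ b → sumTo l (λ j → ⟦ adj G (p l) (p j) ⟧) + ⟦ b ⟧) (irr G (p l)) ⟩
      sumTo l (λ j → ⟦ adj G (p l) (p j) ⟧) + 0            ≡⟨ +-identityʳ _ ⟩
      sumTo l (λ i → ⟦ adj G (p l) (p i) ⟧)                ∎
      where open ≤-Reasoning

    -- Two saturated ends of degree above K/2 on a path of at most K + 1
    -- vertices have crossing chords (Pósa's argument).
    crossing-chords : ∀ p l → l ≤ K → Saturated p l (p 0) → Saturated p l (p l) →
      K < 2 * deg S (p 0) → K < 2 * deg S (p l) →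
      CommonIndex l (λ i → adj G (p 0) (p (suc i))) (λ i → adj G (p l) (p i))
    crossing-chords p l l≤K sat₀ satₗ high₀ highₗ =
      common-index l _ _ (≤-<-trans l≤K (<-≤-trans K<sum (+-mono-≤ (head-degree p l sat₀) (last-degree p l satₗ))))
      where
      K<sum : K < deg S (p 0) + deg S (p l)
      K<sum = *-cancelˡ-≤ 2 (begin
        2 * suc K                          ≡⟨ cong (suc K +_) (+-identityʳ (suc K)) ⟩
        suc K + suc K                      ≤⟨ +-mono-≤ high₀ highₗ ⟩
        2 * deg S (p 0) + 2 * deg S (p l)  ≡⟨ *-distribˡ-+ 2 (deg S (p 0)) _ ⟨
        2 * (deg S (p 0) + deg S (p l))    ∎)
        where open ≤-Reasoning

    -- A path on at most K + 1 vertices without S-neighbours off the path spans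
    -- a piece: inside it every vertex has at most l ≤ K neighbours.
    path-piece : ∀ p l → l ≤ K → IsPath (suc l) p →
      (∀ a b → onPath p l a ≡ true → S b ≡ true → adj G a b ≡ true → onPath p l b ≡ true) →
      Piece K S
    path-piece p l l≤K P closed =
      closed-piece (onPath p l) (p 0) onPath⊆S closed deg≤K (onPath-intro {p} {l} (s≤s z≤n))
      where
      onPath⊆S : onPath p l ⊆ S
      onPath⊆S a on with onPath-witness {p} {l} on
      ... | j , j≤l , refl = inS P j j≤l
      deg≤K : ∀ a → onPath p l a ≡ true → deg (onPath p l) a ≤ K
      deg≤K a on with onPath-witness {p} {l} on
      ... | j , j≤l , refl = ≤-trans (≤-trans (cover n (suc l) p _ covered) (sumTo-hole l _ j j≤l no-loop bounded)) l≤K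
        where
        covered : ∀ w → (onPath p l w ∧ adj G (p j) w) ≡ true → Σ ℕ λ i → i < suc l × p i ≡ w
        covered w h = onPath-witness {p} {l} (proj₁ (∧-true h))
        no-loop : ⟦ onPath p l (p j) ∧ adj G (p j) (p j) ⟧ ≡ 0
        no-loop = trans (cong (λ b → ⟦ onPath p l (p j) ∧ b ⟧) (irr G (p j))) (cong ⟦_⟧ (∧-zeroʳ _))
        bounded : ∀ i → i < suc l → ⟦ onPath p l (p i) ∧ adj G (p j) (p i) ⟧ ≤ 1
        bounded i _ = ⟦⟧≤1 _

    fresh-parts : ∀ p l {v y} → freshNbr p l v y ≡ true →
                  S y ≡ true × adj G v y ≡ true × Avoids (suc l) p y
    fresh-parts p l h with ∧-true h
    ... | Sy , rest with ∧-true rest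
    ... | v~y , off = Sy , v~y , offPath-avoids {p} {l} (not-injective off)

    touching : (ℕ → Fin n) → ℕ → VSet
    touching p l y = S y ∧ (not (onPath p l y) ∧ anyBelow (suc l) (λ j → adj G (p j) y))

    touching-parts : ∀ p l {y} → touching p l y ≡ true →
      S y ≡ true × Avoids (suc l) p y × Σ ℕ λ j → j ≤ l × adj G (p j) y ≡ true
    touching-parts p l {y} h with ∧-true h
    ... | Sy , rest with ∧-true rest
    ... | off , touches with anyBelow-witness (suc l) (λ j → adj G (p j) y) touches
    ... | j , s≤s j≤l , pj~y = Sy , offPath-avoids {p} {l} (not-injective off) , j , j≤l , pj~y

    closed-if-untouched : ∀ p l → (∀ y → touching p l y ≡ false) →
      ∀ a b → onPath p l a ≡ true → S b ≡ true → adj G a b ≡ true → onPath p l b ≡ true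
    closed-if-untouched p l none a b on Sb a~b with onPath p l b in onb
    ... | true  = refl
    ... | false with onPath-witness {p} {l} on
    ... | j , j≤l , refl with none b
    ... | untouched rewrite Sb | onb | anyBelow-intro (suc l) (λ i → adj G (p i) b) j j≤l a~b
      with () ← untouched

    -- The remaining budget d counts the vertices the path may still gain.
    budget : ∀ d l → d + l ≡ K → l ≤ K
    budget d l e = subst (l ≤_) e (m≤n+m l d)

    grow   : ∀ d l p → d + l ≡ K → IsPath (suc l) p → Piece K S
    longer : ∀ d l q → d + l ≡ K → IsPath (suc (suc l)) q → Piece K S
    stuck  : ∀ d l p → d + l ≡ K → IsPath (suc l) p →
             Saturated p l (p 0) → Saturated p l (p l) → Piece K S

    longer zero    l q e Q = ⊥-elim (noLongPath q (subst (λ m → IsPath (suc (suc m)) q) e Q))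
    longer (suc d) l q e Q = grow d (suc l) q (trans (+-suc d l) e) Q

    grow d l p e P with search (freshNbr p l (p 0))
    ... | inj₁ (y , fresh) with fresh-parts p l fresh
    ...   | Sy , p0~y , avoids = longer d l (y ◁ p) e (prepend P Sy (trans (adj-sym G _ _) p0~y) avoids)
    grow d l p e P | inj₂ none₀ with search (freshNbr p l (p l))
    ... | inj₁ (y , fresh) with fresh-parts p l fresh
    ...   | Sy , pl~y , avoids =
      longer d l (y ◁ reverse l p) e
             (prepend (reverse-path P) Sy (trans (adj-sym G _ _) pl~y) (reverse-avoids avoids))
    grow d l p e P | inj₂ none₀ | inj₂ noneₗ =
      stuck d l p e P (saturated p l none₀) (saturated p l noneₗ)

    -- Both ends saturated: a low-degree end is a piece; otherwise close the
    -- path into a cycle, then either leave it through a touching vertex or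
    -- the path spans a piece.
    stuck d l p e P sat₀ satₗ with 2 * deg S (p 0) ≤? K | 2 * deg S (p l) ≤? K
    ... | yes low₀  | _         = low-piece (p 0) (inS P 0 (s≤s z≤n)) low₀
    ... | no  _     | yes lowₗ  = low-piece (p l) (inS P l ≤-refl) lowₗ
    ... | no  high₀ | no  highₗ
      with crossing-chords p l (budget d l e) sat₀ satₗ (≰⇒> high₀) (≰⇒> highₗ)
    ... | i , i<l , chord₀ , chordₗ with search (touching p l)
    ...   | inj₂ none = path-piece p l (budget d l e) P (closed-if-untouched p l none)
    ...   | inj₁ (y , h) with touching-parts p l h
    ...     | Sy , avoids , j , j≤l , pj~y
      with extend-through-cycle i<l P chord₀ chordₗ Sy avoids j≤l pj~y
    ...       | q , Q = longer d l q e Q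

  -- Erdős–Gallai: if G[S] has no path on K + 2 vertices, then 2·e(G[S]) ≤ K·|S|.
  -- Cut off a piece and recurse on the rest of S, which is strictly smaller.
  erdős-gallai-fuel : ∀ K f S → size S < f → NoLongPath K S → degSum S ≤ K * size S
  erdős-gallai-fuel K (suc f) S size<f noLongPath with search S
  ... | inj₂ empty = subst (_≤ K * size S) (sym no-degrees) z≤n
    where
    no-degrees : degSum S ≡ 0
    no-degrees = trans (sumFin-cong n (λ a → cong (λ b → ⟦ b ⟧ * deg S a) (empty a))) (sumFin-zero n)
  ... | inj₁ (x , Sx) =
    piece-bound {K} {S} {part} {S ∖ part} split bound (erdős-gallai-fuel K f (S ∖ part) rest<f noLongPath-rest)
    where
    piece : Piece K S
    piece = FindPiece.grow K S noLongPath K 0 (λ _ → x) (+-identityʳ K) (Paths.singleton G S Sx)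
    open Piece piece
    split : Splits S part (S ∖ part)
    split = splits-∖ part⊆S
    rest<f : size (S ∖ part) < f
    rest<f = ≤-trans (≤-trans (+-monoˡ-≤ (size (S ∖ part)) nonempty) (≤-reflexive (sym (size-split split))))
                     (s≤s⁻¹ size<f)
    noLongPath-rest : NoLongPath K (S ∖ part)
    noLongPath-rest p P = noLongPath p (IsPath-mono (λ w h → proj₁ (∧-true h)) P)

  erdős-gallai : ∀ K S → NoLongPath K S → degSum S ≤ K * size S
  erdős-gallai K S = erdős-gallai-fuel K (suc (size S)) S ≤-refl

path-edge : ∀ {K} (i j : Fin (suc K)) → adj (Path K) i j ≡ true →
            toℕ i ≡ suc (toℕ j) ⊎ toℕ j ≡ suc (toℕ i)
path-edge i j e with ∨-true {toℕ i ≡ᵇ suc (toℕ j)} e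
... | inj₁ i≡j+1 = inj₁ (≡ᵇ-sound i≡j+1)
... | inj₂ j≡i+1 = inj₂ (≡ᵇ-sound j≡i+1)

path-consecutive : ∀ {K} (i j : Fin (suc K)) → toℕ j ≡ suc (toℕ i) → adj (Path K) i j ≡ true
path-consecutive i j j≡i+1 rewrite j≡i+1 =
  trans (cong ((toℕ i ≡ᵇ suc (suc (toℕ i))) ∨_) (≡ᵇ-refl (toℕ i))) (∨-zeroʳ _)

suspended-path : ∀ {n} (G : Graph n) K v {p} → Paths.IsPath G (adj G v) (suc (suc K)) p →
                 Contains (Susp (Path (suc K))) G
suspended-path {n} G K v {p} P = embed , embed-injective , embed-edge
  where
  open Paths G (adj G v)
  embed : Fin (suc (suc (suc K))) → Fin n
  embed zero    = v
  embed (suc i) = p (toℕ i)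
  centre-off-path : ∀ i → v ≡ p (toℕ i) → ⊥
  centre-off-path i e with trans (sym (irr G v)) (subst (λ w → adj G v w ≡ true) (sym e) (inS P (toℕ i) (toℕ<n i)))
  ... | ()
  embed-injective : ∀ {a b} → embed a ≡ embed b → a ≡ b
  embed-injective {zero}  {zero}  _ = refl
  embed-injective {zero}  {suc j} e = ⊥-elim (centre-off-path j e)
  embed-injective {suc i} {zero}  e = ⊥-elim (centre-off-path i (sym e))
  embed-injective {suc i} {suc j} e = cong suc (toℕ-injective (inj P _ _ (toℕ<n i) (toℕ<n j) e))
  embed-edge : ∀ a b → adj (Susp (Path (suc K))) a b ≡ true → adj G (embed a) (embed b) ≡ true
  embed-edge zero    (suc j) _ = inS P (toℕ j) (toℕ<n j)
  embed-edge (suc i) zero    _ = trans (adj-sym G _ _) (inS P (toℕ i) (toℕ<n i))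
  embed-edge (suc i) (suc j) e with path-edge i j e
  ... | inj₁ i≡j+1 rewrite i≡j+1 = trans (adj-sym G _ _) (step P (toℕ j) (subst (_< suc (suc K)) i≡j+1 (toℕ<n i)))
  ... | inj₂ j≡i+1 rewrite j≡i+1 = step P (toℕ i) (subst (_< suc (suc K)) j≡i+1 (toℕ<n j))

short-neighbourhoods : ∀ {n} (G : Graph n) K → Free (Susp (Path (suc K))) G →
                       ∀ v → ErdosGallai.NoLongPath G K (adj G v)
short-neighbourhoods G K free v p P = free (suspended-path G K v P)

two-products≤squares-sorted : ∀ {x y} → x ≤ y → 2 * (x * y) ≤ x * x + y * y
two-products≤squares-sorted {x} x≤y with m≤n⇒∃[o]m+o≡n x≤y
... | c , refl = ≤-trans (m≤m+n _ (c * c)) (≤-reflexive (expand x c))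
  where
  expand : ∀ x c → 2 * (x * (x + c)) + c * c ≡ x * x + (x + c) * (x + c)
  expand = solve-∀

two-products≤squares : ∀ x y → 2 * (x * y) ≤ x * x + y * y
two-products≤squares x y with ≤-total x y
... | inj₁ x≤y = two-products≤squares-sorted x≤y
... | inj₂ y≤x = subst₂ _≤_ (cong (2 *_) (*-comm y x)) (+-comm (y * y) (x * x))
                           (two-products≤squares-sorted y≤x)

-- The arithmetic that combines the three counting inequalities (T: ordered
-- triangles, D: degree sum, Q: sum of squared degrees) into the final bound:
-- from D² ≤ nQ and 2Q ≤ T + nD ≤ (K + n)D we get 2D ≤ n(K + n).
degreeSum-bound : ∀ K n T D Q → T ≤ K * D → Q + Q ≤ T + n * D → D * D ≤ n * Q →
                  D + D ≤ n * K + n * n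
degreeSum-bound K n T zero    Q _   _        _   = z≤n
degreeSum-bound K n T D@(suc _) Q T≤ QQ≤ DD≤ = *-cancelʳ-≤ (D + D) (n * K + n * n) D (begin
  (D + D) * D          ≡⟨ *-distribʳ-+ D D D ⟩
  D * D + D * D        ≤⟨ +-mono-≤ DD≤ DD≤ ⟩
  n * Q + n * Q        ≡⟨ *-distribˡ-+ n Q Q ⟨
  n * (Q + Q)          ≤⟨ *-monoʳ-≤ n (≤-trans QQ≤ (+-monoˡ-≤ (n * D) T≤)) ⟩
  n * (K * D + n * D)  ≡⟨ regroup n K D ⟩
  (n * K + n * n) * D  ∎)
  where
  open ≤-Reasoning
  regroup : ∀ n K D → n * (K * D + n * D) ≡ (n * K + n * n) * D
  regroup = solve-∀

triangle-arithmetic : ∀ K n T D Q → T ≤ K * D → Q + Q ≤ T + n * D → D * D ≤ n * Q →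
                      T + T ≤ K * (n * n) + K * K * n
triangle-arithmetic K n T D Q T≤ QQ≤ DD≤ = begin
  T + T                    ≤⟨ +-mono-≤ T≤ T≤ ⟩
  K * D + K * D            ≡⟨ *-distribˡ-+ K D D ⟨
  K * (D + D)              ≤⟨ *-monoʳ-≤ K (degreeSum-bound K n T D Q T≤ QQ≤ DD≤) ⟩
  K * (n * K + n * n)      ≡⟨ regroup K n ⟩
  K * (n * n) + K * K * n  ∎
  where
  open ≤-Reasoning
  regroup : ∀ K n → K * (n * K + n * n) ≡ K * (n * n) + K * K * n
  regroup = solve-∀

module TriangleCounting {n : ℕ} (G : Graph n) where
  open Degrees G

  ∑² : (Fin n → Fin n → ℕ) → ℕ
  ∑² h = sumFin n (λ a → sumFin n (λ b → h a b))

  ∑³ : (Fin n → Fin n → Fin n → ℕ) → ℕ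
  ∑³ h = sumFin n (λ a → sumFin n (λ b → sumFin n (λ c → h a b c)))

  ∑³-cong : ∀ {f g} → (∀ a b c → f a b c ≡ g a b c) → ∑³ f ≡ ∑³ g
  ∑³-cong e = sumFin-cong n (λ a → sumFin-cong n (λ b → sumFin-cong n (e a b)))

  ∑³-mono : ∀ {f g} → (∀ a b c → f a b c ≤ g a b c) → ∑³ f ≤ ∑³ g
  ∑³-mono e = sumFin-mono n (λ a → sumFin-mono n (λ b → sumFin-mono n (e a b)))

  ∑³-+ : ∀ f g → ∑³ (λ a b c → f a b c + g a b c) ≡ ∑³ f + ∑³ g
  ∑³-+ f g = trans (sumFin-cong n (λ a → trans (sumFin-cong n (λ b → sumFin-+ n (f a b) (g a b)))
                                               (sumFin-+ n _ _)))
                   (sumFin-+ n _ _)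

  ∑³-swap₁₂ : ∀ h → ∑³ h ≡ ∑³ (λ a b c → h b a c)
  ∑³-swap₁₂ h = sumFin-swap n n (λ a b → sumFin n (h a b))

  ∑³-swap₂₃ : ∀ h → ∑³ h ≡ ∑³ (λ a b c → h a c b)
  ∑³-swap₂₃ h = sumFin-cong n (λ a → sumFin-swap n n (h a))

  ∑²-cong : ∀ {f g} → (∀ a b → f a b ≡ g a b) → ∑² f ≡ ∑² g
  ∑²-cong e = sumFin-cong n (λ a → sumFin-cong n (e a))

  ∑²-mono : ∀ {f g} → (∀ a b → f a b ≤ g a b) → ∑² f ≤ ∑² g
  ∑²-mono e = sumFin-mono n (λ a → sumFin-mono n (e a))

  ∑²-+ : ∀ f g → ∑² (λ a b → f a b + g a b) ≡ ∑² f + ∑² g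
  ∑²-+ f g = trans (sumFin-cong n (λ a → sumFin-+ n (f a) (g a))) (sumFin-+ n _ _)

  tri : Fin n → Fin n → Fin n → ℕ
  tri a b c = ⟦ adj G a b ∧ (adj G b c ∧ adj G a c) ⟧

  tri-swap₁₂ : ∀ a b c → tri a b c ≡ tri b a c
  tri-swap₁₂ a b c rewrite adj-sym G b a = cong (λ x → ⟦ adj G a b ∧ x ⟧) (∧-comm (adj G b c) (adj G a c))

  tri-swap₂₃ : ∀ a b c → tri a b c ≡ tri a c b
  tri-swap₂₃ a b c rewrite adj-sym G c b = cong ⟦_⟧ (begin
    adj G a b ∧ (adj G b c ∧ adj G a c) ≡⟨ ∧-assoc (adj G a b) _ _ ⟨
    (adj G a b ∧ adj G b c) ∧ adj G a c ≡⟨ ∧-comm _ (adj G a c) ⟩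
    adj G a c ∧ (adj G a b ∧ adj G b c) ≡⟨ cong (adj G a c ∧_) (∧-comm (adj G a b) _) ⟩
    adj G a c ∧ (adj G b c ∧ adj G a b) ∎)
    where open ≡-Reasoning

  ord : Fin n → Fin n → Fin n → ℕ
  ord a b c = ordered (toℕ a) (toℕ b) (toℕ c)

  triangles-sum : triangles G ≡ ∑³ (λ a b c → ord a b c * tri a b c)
  triangles-sum = ∑³-cong (λ a b c → trans (cong ⟦_⟧ (sym (∧-assoc (toℕ a <ᵇ toℕ b) _ _)))
                                           (⟦∧⟧ ((toℕ a <ᵇ toℕ b) ∧ (toℕ b <ᵇ toℕ c)) _))

  -- Triangle counts weighted by w.  Since tri is symmetric, relabelling the
  -- arguments of the weight does not change the total.
  weighted : (Fin n → Fin n → Fin n → ℕ) → ℕ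
  weighted w = ∑³ (λ a b c → w a b c * tri a b c)

  weighted-+ : ∀ u v → weighted (λ a b c → u a b c + v a b c) ≡ weighted u + weighted v
  weighted-+ u v = trans (∑³-cong (λ a b c → *-distribʳ-+ (tri a b c) (u a b c) (v a b c))) (∑³-+ _ _)

  relabel₁₂ : ∀ w → weighted (λ a b c → w b a c) ≡ weighted w
  relabel₁₂ w = trans (∑³-swap₁₂ _) (∑³-cong (λ a b c → cong (w a b c *_) (sym (tri-swap₁₂ a b c))))

  relabel₂₃ : ∀ w → weighted (λ a b c → w a c b) ≡ weighted w
  relabel₂₃ w = trans (∑³-swap₂₃ _) (∑³-cong (λ a b c → cong (w a b c *_) (sym (tri-swap₂₃ a b c))))

  ord-abc ord-acb ord-bac ord-bca ord-cab ord-cba : Fin n → Fin n → Fin n → ℕ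
  ord-abc a b c = ord a b c
  ord-acb a b c = ord a c b
  ord-bac a b c = ord b a c
  ord-bca a b c = ord b c a
  ord-cab a b c = ord c a b
  ord-cba a b c = ord c b a

  six-orderings : 6 * triangles G ≤ ∑³ tri
  six-orderings = begin
    6 * triangles G                     ≡⟨ cong (6 *_) triangles-sum ⟩
    6 * t                               ≡⟨ six-copies t ⟩
    t + t + t + t + t + t               ≡⟨ cong₂ _+_ (cong₂ _+_ (cong₂ _+_ (cong₂ _+_ (cong₂ _+_ refl acb) bac) bca) cab) cba ⟨
    weighted ord-abc + weighted ord-acb + weighted ord-bac
      + weighted ord-bca + weighted ord-cab + weighted ord-cba
                                        ≡⟨ split-weights ⟨
    weighted (λ a b c → arrangements (toℕ a) (toℕ b) (toℕ c))
                                        ≤⟨ ∑³-mono (λ a b c → *-monoˡ-≤ (tri a b c) (arrangements≤1 (toℕ a) (toℕ b) (toℕ c))) ⟩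
    ∑³ (λ a b c → 1 * tri a b c)        ≡⟨ ∑³-cong (λ a b c → *-identityˡ (tri a b c)) ⟩
    ∑³ tri                              ∎
    where
    open ≤-Reasoning
    t = weighted ord
    six-copies : ∀ t → 6 * t ≡ t + t + t + t + t + t
    six-copies = solve-∀
    acb : weighted ord-acb ≡ t
    acb = relabel₂₃ ord
    bac : weighted ord-bac ≡ t
    bac = relabel₁₂ ord
    bca : weighted ord-bca ≡ t
    bca = trans (relabel₁₂ ord-acb) acb
    cab : weighted ord-cab ≡ t
    cab = trans (relabel₂₃ ord-bac) bac
    cba : weighted ord-cba ≡ t
    cba = trans (relabel₁₂ ord-cab) cab
    split-weights : weighted (λ a b c → arrangements (toℕ a) (toℕ b) (toℕ c))
                  ≡ weighted ord-abc + weighted ord-acb + weighted ord-bac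
                    + weighted ord-bca + weighted ord-cab + weighted ord-cba
    split-weights =
      trans (weighted-+ (λ a b c → ord-abc a b c + ord-acb a b c + ord-bac a b c + ord-bca a b c + ord-cab a b c) ord-cba)
      (cong (_+ weighted ord-cba) (trans (weighted-+ (λ a b c → ord-abc a b c + ord-acb a b c + ord-bac a b c + ord-bca a b c) ord-cab)
      (cong (_+ weighted ord-cab) (trans (weighted-+ (λ a b c → ord-abc a b c + ord-acb a b c + ord-bac a b c) ord-bca)
      (cong (_+ weighted ord-bca) (trans (weighted-+ (λ a b c → ord-abc a b c + ord-acb a b c) ord-bac)
      (cong (_+ weighted ord-bac) (weighted-+ ord-abc ord-acb))))))))

  degree : Fin n → ℕ
  degree a = size (adj G a)

  degreeSum squareSum : ℕ
  degreeSum = sumFin n degree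
  squareSum = sumFin n (λ a → degree a * degree a)

  degree-sym : ∀ a → sumFin n (λ v → ⟦ adj G v a ⟧) ≡ degree a
  degree-sym a = sumFin-cong n (λ v → cong ⟦_⟧ (adj-sym G v a))

  neighbourhoods-count-triangles : sumFin n (λ v → degSum (adj G v)) ≡ ∑³ tri
  neighbourhoods-count-triangles =
    sumFin-cong n (λ v → sumFin-cong n (λ a →
      trans (sym (sumFin-*ˡ n ⟦ adj G v a ⟧ _)) (sumFin-cong n (λ b → term v a b))))
    where
    term : ∀ v a b → ⟦ adj G v a ⟧ * ⟦ adj G v b ∧ adj G a b ⟧ ≡ tri v a b
    term v a b = trans (sym (⟦∧⟧ (adj G v a) _)) (cong (λ x → ⟦ adj G v a ∧ x ⟧) (∧-comm (adj G v b) _))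

  neighbourhood-bound : ∀ K → (∀ v → ErdosGallai.NoLongPath G K (adj G v)) → ∑³ tri ≤ K * degreeSum
  neighbourhood-bound K short = begin
    ∑³ tri                                  ≡⟨ neighbourhoods-count-triangles ⟨
    sumFin n (λ v → degSum (adj G v))       ≤⟨ sumFin-mono n (λ v → ErdosGallai.erdős-gallai G K (adj G v) (short v)) ⟩
    sumFin n (λ v → K * degree v)           ≡⟨ sumFin-*ˡ n K degree ⟩
    K * degreeSum                           ∎
    where open ≤-Reasoning

  codegree : Fin n → Fin n → ℕ
  codegree a b = sumFin n (λ v → ⟦ adj G v a ∧ adj G v b ⟧)

  degree-pair : ∀ a b → degree a + degree b ≤ codegree a b + n
  degree-pair a b = begin
    degree a + degree b                                             ≡⟨ cong₂ _+_ (degree-sym a) (degree-sym b) ⟨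
    sumFin n (λ v → ⟦ adj G v a ⟧) + sumFin n (λ v → ⟦ adj G v b ⟧) ≡⟨ sumFin-+ n _ _ ⟨
    sumFin n (λ v → ⟦ adj G v a ⟧ + ⟦ adj G v b ⟧)                  ≤⟨ sumFin-mono n (λ v → ⟦⟧+⟦⟧≤⟦∧⟧+1 (adj G v a) (adj G v b)) ⟩
    sumFin n (λ v → ⟦ adj G v a ∧ adj G v b ⟧ + 1)                  ≡⟨ sumFin-+ n _ _ ⟩
    codegree a b + sumFin n (λ _ → 1)                               ≡⟨ cong (codegree a b +_) (trans (sumFin-const n 1) (*-identityʳ n)) ⟩
    codegree a b + n                                                ∎
    where open ≤-Reasoning

  triangles-by-edge : ∑³ tri ≡ ∑² (λ a b → ⟦ adj G a b ⟧ * codegree a b)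
  triangles-by-edge =
    trans (∑³-swap₁₂ _) (trans (∑³-swap₂₃ _) (trans (∑³-cong term) (sumFin-cong n (λ a → sumFin-cong n (λ b → sumFin-*ˡ n ⟦ adj G a b ⟧ _)))))
    where
    term : ∀ a b v → tri v a b ≡ ⟦ adj G a b ⟧ * ⟦ adj G v a ∧ adj G v b ⟧
    term a b v = trans (cong ⟦_⟧ (∧-comm-middle (adj G v a) (adj G a b) (adj G v b))) (⟦∧⟧ (adj G a b) _)
      where
      ∧-comm-middle : ∀ p q r → p ∧ (q ∧ r) ≡ q ∧ (p ∧ r)
      ∧-comm-middle p q r = trans (sym (∧-assoc p q r)) (trans (cong (_∧ r) (∧-comm p q)) (∧-assoc q p r))

  -- Summing d(a) + d(b) ≤ codeg(a, b) + n over all ordered edges ab: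
  -- 2 Σ d² ≤ (ordered triangles) + n · 2e.
  squares-bound : squareSum + squareSum ≤ ∑³ tri + n * degreeSum
  squares-bound = begin
    squareSum + squareSum                                         ≡⟨ cong₂ _+_ by-first by-second ⟨
    ∑² (λ a b → ⟦ adj G a b ⟧ * degree a) + ∑² (λ a b → ⟦ adj G a b ⟧ * degree b)
                                                                  ≡⟨ ∑²-+ _ _ ⟨
    ∑² (λ a b → ⟦ adj G a b ⟧ * degree a + ⟦ adj G a b ⟧ * degree b)
                                                                  ≡⟨ ∑²-cong (λ a b → *-distribˡ-+ ⟦ adj G a b ⟧ (degree a) (degree b)) ⟨
    ∑² (λ a b → ⟦ adj G a b ⟧ * (degree a + degree b))            ≤⟨ ∑²-mono (λ a b → *-monoʳ-≤ ⟦ adj G a b ⟧ (degree-pair a b)) ⟩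
    ∑² (λ a b → ⟦ adj G a b ⟧ * (codegree a b + n))              ≡⟨ ∑²-cong (λ a b → *-distribˡ-+ ⟦ adj G a b ⟧ (codegree a b) n) ⟩
    ∑² (λ a b → ⟦ adj G a b ⟧ * codegree a b + ⟦ adj G a b ⟧ * n) ≡⟨ ∑²-+ _ _ ⟩
    ∑² (λ a b → ⟦ adj G a b ⟧ * codegree a b) + ∑² (λ a b → ⟦ adj G a b ⟧ * n)
                                                                  ≡⟨ cong₂ _+_ triangles-by-edge edges-times-n ⟨
    ∑³ tri + n * degreeSum                                        ∎
    where
    open ≤-Reasoning
    by-first : ∑² (λ a b → ⟦ adj G a b ⟧ * degree a) ≡ squareSum
    by-first = sumFin-cong n (λ a → sumFin-*ʳ n (degree a) (λ b → ⟦ adj G a b ⟧))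
    by-second : ∑² (λ a b → ⟦ adj G a b ⟧ * degree b) ≡ squareSum
    by-second = trans (sumFin-swap n n _)
                      (sumFin-cong n (λ b → trans (sumFin-*ʳ n (degree b) (λ a → ⟦ adj G a b ⟧))
                                                  (cong (_* degree b) (degree-sym b))))
    edges-times-n : n * degreeSum ≡ ∑² (λ a b → ⟦ adj G a b ⟧ * n)
    edges-times-n = trans (*-comm n degreeSum)
                          (trans (sym (sumFin-*ʳ n n degree)) (sumFin-cong n (λ a → sym (sumFin-*ʳ n n _))))

  cauchy-schwarz : degreeSum * degreeSum ≤ n * squareSum
  cauchy-schwarz = *-cancelˡ-≤ 2 (begin
    2 * (degreeSum * degreeSum)                              ≡⟨ products ⟨
    ∑² (λ a b → 2 * (degree a * degree b))                   ≤⟨ ∑²-mono (λ a b → two-products≤squares (degree a) (degree b)) ⟩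
    ∑² (λ a b → degree a * degree a + degree b * degree b)   ≡⟨ squares ⟩
    2 * (n * squareSum)                                      ∎)
    where
    open ≤-Reasoning
    products : ∑² (λ a b → 2 * (degree a * degree b)) ≡ 2 * (degreeSum * degreeSum)
    products = trans (sumFin-cong n (λ a → trans (sumFin-*ˡ n 2 _) (cong (2 *_) (sumFin-*ˡ n (degree a) degree))))
                     (trans (sumFin-*ˡ n 2 _) (cong (2 *_) (sumFin-*ʳ n degreeSum degree)))
    squares : ∑² (λ a b → degree a * degree a + degree b * degree b) ≡ 2 * (n * squareSum)
    squares = begin-equality
      ∑² (λ a b → degree a * degree a + degree b * degree b)
        ≡⟨ sumFin-cong n (λ a → trans (sumFin-+ n _ _) (cong (_+ squareSum) (sumFin-const n (degree a * degree a)))) ⟩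
      sumFin n (λ a → n * (degree a * degree a) + squareSum)  ≡⟨ sumFin-+ n _ _ ⟩
      sumFin n (λ a → n * (degree a * degree a)) + sumFin n (λ _ → squareSum)
        ≡⟨ cong₂ _+_ (sumFin-*ˡ n n _) (sumFin-const n squareSum) ⟩
      n * squareSum + n * squareSum                           ≡⟨ cong (n * squareSum +_) (+-identityʳ _) ⟨
      2 * (n * squareSum)                                     ∎

  upper-bound : ∀ K → (∀ v → ErdosGallai.NoLongPath G K (adj G v)) →
                12 * triangles G ≤ K * (n * n) + K * K * n
  upper-bound K short = begin
    12 * triangles G                  ≡⟨ twelve (triangles G) ⟩
    6 * triangles G + 6 * triangles G ≤⟨ +-mono-≤ six-orderings six-orderings ⟩
    ∑³ tri + ∑³ tri                   ≤⟨ triangle-arithmetic K n (∑³ tri) degreeSum squareSum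
                                           (neighbourhood-bound K short) squares-bound cauchy-schwarz ⟩
    K * (n * n) + K * K * n           ∎
    where
    open ≤-Reasoning
    twelve : ∀ t → 12 * t ≡ 6 * t + 6 * t
    twelve = solve-∀

⌊double/2⌋ : ∀ t → ⌊ t + t /2⌋ ≡ t
⌊double/2⌋ zero    = refl
⌊double/2⌋ (suc t) rewrite +-suc t t = cong suc (⌊double/2⌋ t)

⌊double+1/2⌋ : ∀ t → ⌊ suc (t + t) /2⌋ ≡ t
⌊double+1/2⌋ zero    = refl
⌊double+1/2⌋ (suc t) rewrite +-suc t t = cong suc (⌊double+1/2⌋ t)

-- The extremal graph: q disjoint copies of K_{m,m} (the part A, on the labels
-- below H = 2qm) joined completely to an independent set B (the labels from H
-- on).  Label x of A lies in block x / 2m, on the left side iff x % 2m < m.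
module Construction (m′ q : ℕ) where

  m M H : ℕ
  m = suc m′
  M = m + m
  H = q * M

  inA : ℕ → Bool
  inA x = x <ᵇ H

  block pos : ℕ → ℕ
  block x = x / M
  pos   x = x % M

  left : ℕ → Bool
  left x = pos x <ᵇ m

  adjN : ℕ → ℕ → Bool
  adjN x y = if inA x then (if inA y then (block x ≡ᵇ block y) ∧ (left x xor left y) else true)
                      else inA y

  adjN-sym : ∀ x y → adjN x y ≡ adjN y x
  adjN-sym x y with inA x | inA y
  ... | true  | true  = cong₂ _∧_ (≡ᵇ-sym (block x) (block y)) (xor-comm (left x) (left y))
  ... | true  | false = refl
  ... | false | true  = refl
  ... | false | false = refl

  adjN-irr : ∀ x → adjN x x ≡ false
  adjN-irr x with inA x
  ... | false = refl
  ... | true rewrite ≡ᵇ-refl (block x) = xor-same (left x)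

  blowup : ∀ N → Graph N
  blowup N = record { adj = λ i j → adjN (toℕ i) (toℕ j)
                    ; sym = λ i j → adjN-sym (toℕ i) (toℕ j)
                    ; irr = λ i → adjN-irr (toℕ i) }

  same-label : ∀ x y → block x ≡ block y → pos x ≡ pos y → x ≡ y
  same-label x y b p = begin
    x                   ≡⟨ m≡m%n+[m/n]*n x M ⟩
    pos x + block x * M ≡⟨ cong₂ (λ r c → r + c * M) p b ⟩
    pos y + block y * M ≡⟨ m≡m%n+[m/n]*n y M ⟨
    y                   ∎
    where open ≡-Reasoning

  edge-in-A : ∀ x y → inA x ≡ true → inA y ≡ true → adjN x y ≡ true →
              block x ≡ block y × (left x xor left y) ≡ true
  edge-in-A x y x∈A y∈A x~y rewrite x∈A | y∈A with block x ≡ᵇ block y in same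
  ... | true = ≡ᵇ-sound same , x~y

  edge-from-B : ∀ x y → inA x ≡ false → adjN x y ≡ inA y
  edge-from-B x y x∉A rewrite x∉A = refl

  opposite-side : ∀ a b → (a xor b) ≡ true → b ≡ not a
  opposite-side true  false _ = refl
  opposite-side false true  _ = refl

  sidePos : ℕ → ℕ
  sidePos x = if left x then pos x else pos x ∸ m

  sidePos<m : ∀ x → sidePos x < m
  sidePos<m x with left x in side
  ... | true  = <ᵇ-sound side
  ... | false = subst (pos x ∸ m <_) (m+n∸m≡n m m) (∸-monoˡ-< (m%n<n x M) (<ᵇ-sound-false {pos x} {m} side))

  sidePos-inj : ∀ x y → left x ≡ left y → sidePos x ≡ sidePos y → pos x ≡ pos y
  sidePos-inj x y same-side e with left x in sx | left y in sy
  ... | true  | true  = e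
  ... | false | false = begin
    pos x           ≡⟨ m∸n+n≡m (<ᵇ-sound-false {pos x} {m} sx) ⟨
    pos x ∸ m + m   ≡⟨ cong (_+ m) e ⟩
    pos y ∸ m + m   ≡⟨ m∸n+n≡m (<ᵇ-sound-false {pos y} {m} sy) ⟩
    pos y           ∎
    where open ≡-Reasoning
  ... | true  | false with () ← same-side
  ... | false | true  with () ← same-side

  record SuspendedPath (L : ℕ) : Set where
    field
      centre : ℕ
      path   : ℕ → ℕ
      spoke  : ∀ t → t < L → adjN centre (path t) ≡ true
      step   : ∀ t → suc t < L → adjN (path t) (path (suc t)) ≡ true
      inj    : ∀ t u → t < L → u < L → path t ≡ path u → t ≡ u

  embedding-labels : ∀ N K → Contains (Susp (Path (suc K))) (blowup N) → SuspendedPath (suc (suc K))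
  embedding-labels N K (f , f-inj , f-edge) = record
    { centre = toℕ (f zero) ; path = label ; spoke = spoke ; step = step ; inj = inj }
    where
    L = suc (suc K)
    label : ℕ → ℕ
    label t with t <? L
    ... | yes t<L = toℕ (f (suc (fromℕ< t<L)))
    ... | no  _   = 0
    label-eq : ∀ t (t<L : t < L) → label t ≡ toℕ (f (suc (fromℕ< t<L)))
    label-eq t t<L with t <? L
    ... | yes _   = refl
    ... | no  t≮L = ⊥-elim (t≮L t<L)
    spoke : ∀ t → t < L → adjN (toℕ (f zero)) (label t) ≡ true
    spoke t t<L rewrite label-eq t t<L = f-edge zero (suc (fromℕ< t<L)) refl
    step : ∀ t → suc t < L → adjN (label t) (label (suc t)) ≡ true
    step t t+1<L rewrite label-eq t (<-trans (n<1+n t) t+1<L) | label-eq (suc t) t+1<L =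
      f-edge (suc (fromℕ< t<L)) (suc (fromℕ< t+1<L)) consecutive
      where
      t<L = <-trans (n<1+n t) t+1<L
      consecutive : adj (Path (suc K)) (fromℕ< t<L) (fromℕ< t+1<L) ≡ true
      consecutive = path-consecutive (fromℕ< t<L) (fromℕ< t+1<L)
                      (trans (toℕ-fromℕ< t+1<L) (cong suc (sym (toℕ-fromℕ< t<L))))
    inj : ∀ t u → t < L → u < L → label t ≡ label u → t ≡ u
    inj t u t<L u<L e rewrite label-eq t t<L | label-eq u u<L = begin
      t                    ≡⟨ toℕ-fromℕ< t<L ⟨
      toℕ (fromℕ< t<L)     ≡⟨ cong toℕ (Fin-suc-injective (f-inj (toℕ-injective e))) ⟩
      toℕ (fromℕ< u<L)     ≡⟨ toℕ-fromℕ< u<L ⟩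
      u                    ∎
      where open ≡-Reasoning

  module NoSuspendedPath {L : ℕ} (P : SuspendedPath L) where
    open SuspendedPath P

    -- Centre in B: the whole path lies in A, and being connected it stays in
    -- one block, which has only M vertices.
    centre-in-B : inA centre ≡ false → M < L → ⊥
    centre-in-B c∉A M<L = collision (pigeonhole M<L position)
      where
      path∈A : ∀ t → t < L → inA (path t) ≡ true
      path∈A t t<L = trans (sym (edge-from-B centre _ c∉A)) (spoke t t<L)
      one-block : ∀ t → t < L → block (path t) ≡ block (path 0)
      one-block zero    _       = refl
      one-block (suc t) t+1<L = trans (sym (proj₁ (edge-in-A _ _ (path∈A t t<L) (path∈A (suc t) t+1<L) (step t t+1<L))))
                                      (one-block t t<L)
        where t<L = <-trans (n<1+n t) t+1<L
      position : Fin L → Fin M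
      position i = fromℕ< (m%n<n (path (toℕ i)) M)
      collision : (Σ (Fin L) λ i → Σ (Fin L) λ j → toℕ i < toℕ j × position i ≡ position j) → ⊥
      collision (i , j , i<j , same-pos) = <-irrefl (inj _ _ (toℕ<n i) (toℕ<n j) same) i<j
        where
        same : path (toℕ i) ≡ path (toℕ j)
        same = same-label _ _ (trans (one-block _ (toℕ<n i)) (sym (one-block _ (toℕ<n j))))
                 (trans (sym (toℕ-fromℕ< _)) (trans (cong toℕ same-pos) (toℕ-fromℕ< _)))

    -- Centre in A: B is independent, so of any two consecutive path vertices one
    -- lies in A; this gives m + 1 distinct path vertices in A, all adjacent to
    -- the centre, hence on the opposite side of its block, which has only m.
    centre-in-A : inA centre ≡ true → suc M < L → ⊥
    centre-in-A c∈A M+1<L = collision (pigeonhole (n<1+n m) sideIndex)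
      where
      pair-bound : ∀ t → t ≤ m → suc (t + t) < L
      pair-bound t t≤m = ≤-<-trans (s≤s (+-mono-≤ t≤m t≤m)) M+1<L
      pick : ∀ t → t ≤ m → Σ ℕ λ s → ⌊ s /2⌋ ≡ t × s < L × inA (path s) ≡ true
      pick t t≤m with inA (path (t + t)) in inA₀
      ... | true  = t + t , ⌊double/2⌋ t , <-trans (n<1+n _) (pair-bound t t≤m) , inA₀
      ... | false = suc (t + t) , ⌊double+1/2⌋ t , pair-bound t t≤m ,
                    trans (sym (edge-from-B _ _ inA₀)) (step (t + t) (pair-bound t t≤m))
      index : Fin (suc m) → ℕ
      index i = proj₁ (pick (toℕ i) (s≤s⁻¹ (toℕ<n i)))
      index<L : ∀ i → index i < L
      index<L i = proj₁ (proj₂ (proj₂ (pick (toℕ i) (s≤s⁻¹ (toℕ<n i)))))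
      vertex : Fin (suc m) → ℕ
      vertex i = path (index i)
      vertex∈A : ∀ i → inA (vertex i) ≡ true
      vertex∈A i = proj₂ (proj₂ (proj₂ (pick (toℕ i) (s≤s⁻¹ (toℕ<n i)))))
      index-inj : ∀ i j → index i ≡ index j → toℕ i ≡ toℕ j
      index-inj i j e = trans (sym (proj₁ (proj₂ (pick (toℕ i) _))))
                              (trans (cong ⌊_/2⌋ e) (proj₁ (proj₂ (pick (toℕ j) _))))
      beside-centre : ∀ i → block centre ≡ block (vertex i) × left (vertex i) ≡ not (left centre)
      beside-centre i with edge-in-A centre (vertex i) c∈A (vertex∈A i) (spoke (index i) (index<L i))
      ... | same-block , opposite = same-block , opposite-side (left centre) (left (vertex i)) opposite
      sideIndex : Fin (suc m) → Fin m
      sideIndex i = fromℕ< (sidePos<m (vertex i))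
      collision : (Σ (Fin (suc m)) λ i → Σ (Fin (suc m)) λ j → toℕ i < toℕ j × sideIndex i ≡ sideIndex j) → ⊥
      collision (i , j , i<j , same-side-pos) = <-irrefl (index-inj i j (inj _ _ (index<L i) (index<L j) same)) i<j
        where
        same : vertex i ≡ vertex j
        same = same-label (vertex i) (vertex j)
          (trans (sym (proj₁ (beside-centre i))) (proj₁ (beside-centre j)))
          (sidePos-inj (vertex i) (vertex j) (trans (proj₂ (beside-centre i)) (sym (proj₂ (beside-centre j))))
            (trans (sym (toℕ-fromℕ< _)) (trans (cong toℕ same-side-pos) (toℕ-fromℕ< _))))

    no-suspended-path : suc M < L → ⊥
    no-suspended-path M+1<L with inA centre in centre∈A?
    ... | false = centre-in-B centre∈A? (<-trans (n<1+n M) M+1<L)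
    ... | true  = centre-in-A centre∈A? M+1<L

  blowup-free : ∀ N K → M ≤ K → Free (Susp (Path (suc K))) (blowup N)
  blowup-free N K M≤K copy =
    NoSuspendedPath.no-suspended-path (embedding-labels N K copy) (s≤s (s≤s M≤K))

  pos-label : ∀ c r → r < M → pos (c * M + r) ≡ r
  pos-label c r r<M = trans (cong (_% M) (+-comm (c * M) r)) (trans ([m+kn]%n≡m%n r c M) (m<n⇒m%n≡m r<M))

  block-label : ∀ c r → r < M → block (c * M + r) ≡ c
  block-label c r r<M = sym (*-cancelʳ-≡ c (block (c * M + r)) M (+-cancelˡ-≡ r (c * M) _ (begin
    r + c * M                                ≡⟨ +-comm r (c * M) ⟩
    c * M + r                                ≡⟨ m≡m%n+[m/n]*n (c * M + r) M ⟩
    pos (c * M + r) + block (c * M + r) * M  ≡⟨ cong (_+ block (c * M + r) * M) (pos-label c r r<M) ⟩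
    r + block (c * M + r) * M                ∎)))
    where open ≡-Reasoning

  label<H : ∀ c r → c < q → r < M → c * M + r < H
  label<H c r c<q r<M = <-≤-trans (+-monoʳ-< (c * M) r<M)
                                  (≤-trans (≤-reflexive (+-comm (c * M) M)) (*-monoˡ-≤ M c<q))

  edgeA : ℕ → ℕ → ℕ
  edgeA a b = ⟦ (a <ᵇ b) ∧ adjN a b ⟧

  block-edge : ∀ c r s → c < q → r < m → m ≤ s → s < M → edgeA (c * M + r) (c * M + s) ≡ 1
  block-edge c r s c<q r<m m≤s s<M
    rewrite <ᵇ-true (+-monoʳ-< (c * M) (<-≤-trans r<m m≤s))
          | <ᵇ-true (label<H c r c<q (≤-trans r<m (m≤m+n m m))) | <ᵇ-true (label<H c s c<q s<M)
          | block-label c r (≤-trans r<m (m≤m+n m m)) | block-label c s s<M | ≡ᵇ-refl c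
          | pos-label c r (≤-trans r<m (m≤m+n m m)) | pos-label c s s<M
          | <ᵇ-true r<m | <ᵇ-false m≤s = refl

  left-degree : ∀ c r → c < q → r < m → m ≤ sumTo H (edgeA (c * M + r))
  left-degree c r c<q r<m = begin
    m                                                      ≡⟨ trans (sym (*-identityʳ m)) (sym (sumTo-const m 1)) ⟩
    sumTo m (λ _ → 1)                                      ≡⟨ sumTo-cong m (λ j j<m → block-edge c r (m + j) c<q r<m (m≤m+n m j) (+-monoʳ-< m j<m)) ⟨
    sumTo m (λ j → edgeA a (c * M + (m + j)))              ≤⟨ sumTo-suffix m m (λ s → edgeA a (c * M + s)) ⟩
    sumTo M (λ s → edgeA a (c * M + s))                    ≤⟨ sumTo-term q (λ c′ → sumTo M (λ s → edgeA a (c′ * M + s))) c c<q ⟩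
    sumTo q (λ c′ → sumTo M (λ s → edgeA a (c′ * M + s)))  ≡⟨ sumTo-blocks q M (edgeA a) ⟨
    sumTo H (edgeA a)                                      ∎
    where
    open ≤-Reasoning
    a = c * M + r

  edges-in-A : q * (m * m) ≤ sumTo H (λ a → sumTo H (edgeA a))
  edges-in-A = begin
    q * (m * m)                                            ≡⟨ trans (sym (sumTo-const q (m * m))) (sumTo-cong q (λ _ _ → sym (sumTo-const m m))) ⟩
    sumTo q (λ _ → sumTo m (λ _ → m))                      ≤⟨ sumTo-mono q (λ c c<q → sumTo-mono m (λ r r<m → left-degree c r c<q r<m)) ⟩
    sumTo q (λ c → sumTo m (λ r → degreeA (c * M + r)))    ≤⟨ sumTo-mono q (λ c _ → sumTo-prefix m m (λ r → degreeA (c * M + r))) ⟩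
    sumTo q (λ c → sumTo M (λ r → degreeA (c * M + r)))    ≡⟨ sumTo-blocks q M degreeA ⟨
    sumTo H degreeA                                        ∎
    where
    open ≤-Reasoning
    degreeA : ℕ → ℕ
    degreeA a = sumTo H (edgeA a)

  triangleN : ℕ → ℕ → ℕ → ℕ
  triangleN a b c = ⟦ (a <ᵇ b) ∧ ((b <ᵇ c) ∧ (adjN a b ∧ (adjN b c ∧ adjN a c))) ⟧

  triangles-blowup : ∀ N → triangles (blowup N) ≡ sumTo N (λ a → sumTo N (λ b → sumTo N (triangleN a b)))
  triangles-blowup N =
    trans (sumFin-cong N (λ a → trans (sumFin-cong N (λ b → sumFin-toℕ N (triangleN (toℕ a) (toℕ b))))
                                      (sumFin-toℕ N (λ b → sumTo N (triangleN (toℕ a) b)))))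
          (sumFin-toℕ N (λ a → sumTo N (λ b → sumTo N (triangleN a b))))

  A-B-edge : ∀ x y → x < H → H ≤ y → adjN x y ≡ true
  A-B-edge x y x<H H≤y rewrite <ᵇ-true x<H | <ᵇ-false H≤y = refl

  triangle-over-B : ∀ a b i → a < H → b < H → triangleN a b (H + i) ≡ edgeA a b
  triangle-over-B a b i a<H b<H
    rewrite <ᵇ-true (≤-trans b<H (m≤m+n H i))
          | A-B-edge b (H + i) b<H (m≤m+n H i) | A-B-edge a (H + i) a<H (m≤m+n H i) =
    cong ⟦_⟧ (cong ((a <ᵇ b) ∧_) (∧-identityʳ (adjN a b)))

  triangles-lower : H * (q * (m * m)) ≤ triangles (blowup (H + H))
  triangles-lower = begin
    H * (q * (m * m))                                          ≤⟨ *-monoʳ-≤ H edges-in-A ⟩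
    H * sumTo H (λ a → sumTo H (edgeA a))                      ≡⟨ sumTo-*ˡ H H _ ⟨
    sumTo H (λ a → H * sumTo H (edgeA a))                      ≡⟨ sumTo-cong H (λ a _ → sumTo-*ˡ H H (edgeA a)) ⟨
    sumTo H (λ a → sumTo H (λ b → H * edgeA a b))              ≡⟨ sumTo-cong H (λ a a<H → sumTo-cong H (λ b b<H →
                                                                    trans (sym (sumTo-const H (edgeA a b)))
                                                                          (sumTo-cong H (λ i _ → sym (triangle-over-B a b i a<H b<H))))) ⟩
    sumTo H (λ a → sumTo H (λ b → sumTo H (λ i → triangleN a b (H + i))))
                                                               ≤⟨ sumTo-mono H (λ a _ → sumTo-mono H (λ b _ → sumTo-suffix H H (triangleN a b))) ⟩
    sumTo H (λ a → sumTo H (λ b → sumTo N (triangleN a b)))    ≤⟨ sumTo-mono H (λ a _ → sumTo-prefix H H (λ b → sumTo N (triangleN a b))) ⟩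
    sumTo H (λ a → sumTo N (λ b → sumTo N (triangleN a b)))    ≤⟨ sumTo-prefix H H (λ a → sumTo N (λ b → sumTo N (triangleN a b))) ⟩
    sumTo N (λ a → sumTo N (λ b → sumTo N (triangleN a b)))    ≡⟨ triangles-blowup N ⟨
    triangles (blowup N)                                       ∎
    where
    open ≤-Reasoning
    N = H + H

lower-bound : ∀ n K → 2 ≤ K → 4 * (K / 2) ∣ n →
  Σ (Graph n) λ G → Free (Susp (Path (suc K))) G × (K / 2) * (n * n) ≤ 8 * triangles G
lower-bound n K 2≤K 4m∣n with K / 2 | m/n*n≤m K 2 | m≥n⇒m/n>0 {K} {2} 2≤K | 4m∣n
... | zero   | _    | ()  | _
... | suc m′ | 2m≤K | _   | divides q refl = blowup N , blowup-free N K 2m≤K′ , triangle-count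
  where
  open Construction m′ q
  N = q * (4 * m)
  2m≤K′ : M ≤ K
  2m≤K′ = ≤-trans (≤-reflexive (double m)) 2m≤K
    where
    double : ∀ m → m + m ≡ m * 2
    double = solve-∀
  triangle-count : m * (N * N) ≤ 8 * triangles (blowup N)
  triangle-count = begin
    m * (N * N)                ≡⟨ regroup m′ q ⟩
    8 * (H * (q * (m * m)))    ≤⟨ *-monoʳ-≤ 8 (subst (λ N′ → H * (q * (m * m)) ≤ triangles (blowup N′))
                                                     (sym (two-halves m′ q)) triangles-lower) ⟩
    8 * triangles (blowup N)   ∎
    where
    open ≤-Reasoning
    regroup : ∀ m′ q → suc m′ * (q * (4 * suc m′) * (q * (4 * suc m′)))
                     ≡ 8 * (q * (suc m′ + suc m′) * (q * (suc m′ * suc m′)))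
    regroup = solve-∀
    two-halves : ∀ m′ q → q * (4 * suc m′) ≡ q * (suc m′ + suc m′) + q * (suc m′ + suc m′)
    two-halves = solve-∀

proposition1p3 : (n k : ℕ) → 3 ≤ k → k ≤ n →
    ((G : Graph n) → Free (Susp (Path k)) G →
      12 * triangles G ≤ (k ∸ 1) * (n * n) + (k ∸ 1) * (k ∸ 1) * n)
    × (4 * ((k ∸ 1) / 2) ∣ n →
      Σ (Graph n) λ G → Free (Susp (Path k)) G
        × ((k ∸ 1) / 2) * (n * n) ≤ 8 * triangles G)
proposition1p3 n (suc K) (s≤s 2≤K) _ =
  (λ G free → TriangleCounting.upper-bound G K (short-neighbourhoods G K free)) ,
  lower-bound n K 2≤K
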